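{- Let $M$ be a matroid and, for $e\in E(M)$, let $\mathcal{Z}_e=\{A\in\mathcal{Z}(M): e\in A\}$. Assume that for some $x,y\in E(M)$: (i) both $\mathcal{Z}_x-\mathcal{Z}_y$ and $\mathcal{Z}_y-\mathcal{Z}_x$ are nonempty, and (ii) whenever $X\in\mathcal{Z}_x-\mathcal{Z}_y$ and $Y\in\mathcal{Z}_y-\mathcal{Z}_x$, the pair $(X,Y)$ is not modular in $M$. For each $Y\in\mathcal{Z}_y-\mathcal{Z}_x$ let $Y_x=(Y-y)\cup x$, let $$\mathcal{Z}'=(\mathcal{Z}(M)-(\mathcal{Z}_y-\mathcal{Z}_x))\cup\{Y_x: Y\in\mathcal{Z}_y-\mathcal{Z}_x\},$$ and define $r':\mathcal{Z}'\to\mathbb{Z}$ by $r'(A)=r_M(A)$ if $A\in\mathcal{Z}(M)$ and $r'(Y_x)=r_M(Y)$ for $Y\in\mathcal{Z}_y-\mathcal{Z}_x$. Then there is a matroid $M'$ on $E(M)$ whose set of cyclic flats is $\mathcal{Z}'$ and whose rank function agrees with $r'$ on $\mathcal{Z}'$. The matroids $M$ and $M'$ have the same configuration but are not isomorphic. Moreover, $M'$ is isomorphic to the matroid obtained by the same construction with the roles of $x$ and $y$ interchanged.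
   Context: All matroids are finite. A cyclic flat of a matroid $M$ is a flat that is a (possibly empty) union of circuits, equivalently a flat $F$ such that $M|F$ has no coloops; $\mathcal{Z}(M)$ denotes the set of cyclic flats, which is a lattice under inclusion. A pair $(X,Y)$ of subsets of $E(M)$ is modular if $r(X)+r(Y)=r(X\cup Y)+r(X\cap Y)$. Two matroids $M$ and $N$ have the same configuration if $|E(M)|=|E(N)|$ and there is a lattice isomorphism $\Phi:\mathcal{Z}(M)\to\mathcal{Z}(N)$ with $|\Phi(F)|=|F|$ and $r_N(\Phi(F))=r_M(F)$ for all $F\in\mathcal{Z}(M)$. -}

module Defs where

open import Data.Nat using (ℕ; _≤_; _<_; _+_)
open import Data.Fin using (Fin)
open import Data.Fin.Subset using (Subset; _∈_; _∉_; _⊆_; _∪_; _∩_; _-_; ⁅_⁆; ∣_∣)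
open import Data.Fin.Permutation using (Permutation′; _⟨$⟩ˡ_)
open import Data.Vec using (tabulate; lookup)
open import Data.Product using (Σ; ∃; _×_; _,_)
open import Data.Sum using (_⊎_)
open import Relation.Binary.PropositionalEquality using (_≡_)
open import Relation.Nullary using (¬_)

record Matroid (n : ℕ) : Set where
  field
    r        : Subset n → ℕ
    r-bound  : ∀ X → r X ≤ ∣ X ∣
    r-mono   : ∀ X Y → X ⊆ Y → r X ≤ r Y
    r-submod : ∀ X Y → r (X ∪ Y) + r (X ∩ Y) ≤ r X + r Y
open Matroid public

module _ {n : ℕ} (M : Matroid n) where

  Flat : Subset n → Set
  Flat F = ∀ e → e ∉ F → r M F < r M (F ∪ ⁅ e ⁆)

  NoColoops : Subset n → Set
  NoColoops F = ∀ e → e ∈ F → r M (F - e) ≡ r M F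

  CyclicFlat : Subset n → Set
  CyclicFlat F = Flat F × NoColoops F

  Modular : Subset n → Subset n → Set
  Modular X Y = r M X + r M Y ≡ r M (X ∪ Y) + r M (X ∩ Y)

  InZdiff : Fin n → Fin n → Subset n → Set
  InZdiff e f A = CyclicFlat A × e ∈ A × f ∉ A

swapElt : {n : ℕ} → Fin n → Fin n → Subset n → Subset n
swapElt x y Y = (Y - y) ∪ ⁅ x ⁆

InZ' : {n : ℕ} → Matroid n → Fin n → Fin n → Subset n → Set
InZ' M x y A =
  (CyclicFlat M A × ¬ InZdiff M y x A)
  ⊎ (Σ (Subset _) λ Y → InZdiff M y x Y × A ≡ swapElt x y Y)

IsConstruction : {n : ℕ} → Matroid n → Fin n → Fin n → Matroid n → Set
IsConstruction M x y M' =
  (∀ A → (CyclicFlat M' A → InZ' M x y A) × (InZ' M x y A → CyclicFlat M' A))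
  × (∀ A → CyclicFlat M A → ¬ InZdiff M y x A → r M' A ≡ r M A)
  × (∀ Y → InZdiff M y x Y → r M' (swapElt x y Y) ≡ r M Y)

-- Same configuration (ground sets both Fin n, so |E(M)| = |E(N)|):
-- a lattice isomorphism 𝒵(M) → 𝒵(N) (given as an order isomorphism
-- Φ with inverse Ψ) preserving sizes and ranks.
record SameConfiguration {n : ℕ} (M N : Matroid n) : Set where
  field
    Φ Ψ   : Subset n → Subset n
    Φ-cf  : ∀ F → CyclicFlat M F → CyclicFlat N (Φ F)
    Ψ-cf  : ∀ G → CyclicFlat N G → CyclicFlat M (Ψ G)
    ΨΦ    : ∀ F → CyclicFlat M F → Ψ (Φ F) ≡ F
    ΦΨ    : ∀ G → CyclicFlat N G → Φ (Ψ G) ≡ G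
    Φ-mono : ∀ F G → CyclicFlat M F → CyclicFlat M G → F ⊆ G → Φ F ⊆ Φ G
    Ψ-mono : ∀ F G → CyclicFlat N F → CyclicFlat N G → F ⊆ G → Ψ F ⊆ Ψ G
    Φ-size : ∀ F → CyclicFlat M F → ∣ Φ F ∣ ≡ ∣ F ∣
    Φ-rank : ∀ F → CyclicFlat M F → r N (Φ F) ≡ r M F

image : {n : ℕ} → Permutation′ n → Subset n → Subset n
image σ X = tabulate λ i → lookup X (σ ⟨$⟩ˡ i)

Isomorphic : {n : ℕ} → Matroid n → Matroid n → Set
Isomorphic M N = Σ (Permutation′ _) λ σ → ∀ X → r N (image σ X) ≡ r M X

-- Write S_y = (S - x) ∪ {y} and S_x = (S - y) ∪ {x}. The matroid M′ is given by its rank function: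
-- r′(S) = min (r S) (r S_y) if x ∈ S ∌ y, r′(S) = max (r S) (r S_x) if y ∈ S ∌ x, and r′(S) = r S
-- otherwise. It suffices to check monotonicity and submodularity on one- and two-element extensions.
-- All cases follow from submodularity of r except the minimum around a set X with x ∈ X ∌ y, where
-- a failure would need r(X ∪ a) < r(X_y ∪ a) and r(X_y ∪ b) < r(X ∪ b). Cyclic flats G attaining
-- r(S) = min (r G + |S - G|) for these two sets then lie in 𝒵_x - 𝒵_y and 𝒵_y - 𝒵_x, and hypothesis
-- (ii) makes them non-modular, which is incompatible with the two inequalities.
-- For a cyclic flat Y ∈ 𝒵_y - 𝒵_x one has r(Y_x) = r(Y) + 1, so r′ keeps every other cyclic flat
-- of M and replaces Y by Y_x with rank r(Y); this gives 𝒵(M′) = 𝒵′ and the configuration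
-- isomorphism. Transposing x and y carries r′ to the rank function built with x and y interchanged.
-- Finally, count the pairs (f, e) such that every cyclic flat containing f contains e. This count
-- is an isomorphism invariant; pairing (f, e) with its image under the transposition, M′ never has
-- fewer such pairs than M, and (y, x) is such a pair of M′ but not of M.

module Submission where

open import Defs
open import Data.Bool using (Bool; true; false; _∧_; _∨_; not; T)
open import Data.Bool.Properties using (T-≡)
open import Data.Empty using (⊥; ⊥-elim)
open import Data.Fin using (Fin; zero; suc)
open import Data.Fin.Permutation using (Permutation′; _⟨$⟩ˡ_; _⟨$⟩ʳ_; inverseˡ; inverseʳ; flip; transpose)
import Data.Fin.Permutation.Components as PC
open import Data.Fin.Properties using (any?; all?) renaming (_≟_ to _≟ᶠ_)
open import Data.Fin.Subset
  using (Subset; _∈_; _∉_; _⊆_; _∪_; _∩_; _─_; _-_; ⁅_⁆; ∣_∣; Empty)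
  renaming (⊥ to ∅)
open import Data.Fin.Subset.Properties
  using (_∈?_; ∉⊥; x∈⁅x⁆; x∈⁅y⁆⇒x≡y; ∣⊥∣≡0; ∣⁅x⁆∣≡1; ⊆-refl; ⊆-trans; ⊆-antisym; nonempty?;
         p⊆p∪q; q⊆p∪q; x∈p∪q⁺; x∈p∪q⁻; x∈p∩q⁺; x∈p∩q⁻; p∩q⊆q; p─q⊆p; x∈p∧x∉q⇒x∈p─q; x∈p∧x≢y⇒x∈p-y;
         p⊆q⇒∣p∣≤∣q∣; p⊂q⇒∣p∣<∣q∣; x∈p⇒∣p-x∣<∣p∣; ∪-comm; ∩-comm; anySubset?)
open import Data.Nat using (ℕ; zero; suc; _+_; _≤_; _<_; _⊓_; _⊔_; _≤ᵇ_; _≡ᵇ_; z≤n; s≤s)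
open import Data.Nat.Induction using (<-wellFounded)
open import Data.Nat.Properties
open import Algebra.Properties.CommutativeMonoid.Sum +-0-commutativeMonoid
  using (sum; sum-permute; sum-cong-≗; ∑-distrib-+)
open import Data.Nat.Tactic.RingSolver using (solve-∀)
open import Data.Product using (Σ; ∃; _×_; _,_; proj₁; proj₂)
open import Data.Sum using (_⊎_; inj₁; inj₂)
open import Data.Vec using (Vec; []; _∷_; here; there; lookup; map; tabulate; zipWith)
open import Data.Vec.Properties
  using (lookup-map; lookup-zipWith; lookup∘tabulate; tabulate∘lookup; tabulate-cong; []=⇒lookup; lookup⇒[]=)
open import Function.Bundles using (Equivalence)
open import Induction.WellFounded using (Acc; acc)
open import Relation.Binary.PropositionalEquality
open import Relation.Nullary using (¬_; Dec; yes; no)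
open import Relation.Nullary.Decidable using (_×-dec_; _→-dec_; ¬?; dec-true; dec-false)

private
  variable
    k n : ℕ

lookup-∪ : ∀ (p q : Subset n) i → lookup (p ∪ q) i ≡ (lookup p i ∨ lookup q i)
lookup-∪ p q i = lookup-zipWith _∨_ i p q

lookup-∩ : ∀ (p q : Subset n) i → lookup (p ∩ q) i ≡ (lookup p i ∧ lookup q i)
lookup-∩ p q i = lookup-zipWith _∧_ i p q

lookup-─ : ∀ (p q : Subset n) i → lookup (p ─ q) i ≡ (lookup p i ∧ not (lookup q i))
lookup-─ (a ∷ p) (true ∷ q) zero with a
... | true = refl
... | false = refl
lookup-─ (a ∷ p) (false ∷ q) zero with a
... | true = refl
... | false = refl
lookup-─ (_ ∷ p) (_ ∷ q) (suc i) = lookup-─ p q i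

lookup-∅ : ∀ (i : Fin n) → lookup ∅ i ≡ false
lookup-∅ zero = refl
lookup-∅ (suc i) = lookup-∅ i

∉⇒lookup : ∀ {p : Subset n} {i} → i ∉ p → lookup p i ≡ false
∉⇒lookup {p = p} {i} i∉p with lookup p i in eq
... | true = ⊥-elim (i∉p (lookup⇒[]= i p eq))
... | false = refl

lookup-⇔ : ∀ {S : Subset n} {i j} → (i ∈ S → j ∈ S) → (j ∈ S → i ∈ S) → lookup S i ≡ lookup S j
lookup-⇔ {S = S} {i} {j} to from with lookup S i in eqᵢ | lookup S j in eqⱼ
... | true | true = refl
... | false | false = refl
... | true | false = sym (trans (sym eqⱼ) ([]=⇒lookup (to (lookup⇒[]= i S eqᵢ))))
... | false | true = trans (sym eqᵢ) ([]=⇒lookup (from (lookup⇒[]= j S eqⱼ)))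

x∈p─q⇒x∉q : ∀ {p q : Subset n} {i} → i ∈ p ─ q → i ∉ q
x∈p─q⇒x∉q {p = _ ∷ _} {true ∷ _} () here
x∈p─q⇒x∉q {p = _ ∷ _} {_ ∷ _} (there i∈p─q) (there i∈q) = x∈p─q⇒x∉q i∈p─q i∈q

x∈p∪⁅x⁆ : ∀ (p : Subset n) x → x ∈ p ∪ ⁅ x ⁆
x∈p∪⁅x⁆ p x = x∈p∪q⁺ (inj₂ (x∈⁅x⁆ x))

x∈p∪⁅y⁆⇒x∈p : ∀ {p : Subset n} {x y} → x ∈ p ∪ ⁅ y ⁆ → x ≢ y → x ∈ p
x∈p∪⁅y⁆⇒x∈p {p = p} {y = y} x∈ x≢y with x∈p∪q⁻ p ⁅ y ⁆ x∈
... | inj₁ x∈p = x∈p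
... | inj₂ x∈y = ⊥-elim (x≢y (x∈⁅y⁆⇒x≡y y x∈y))

x∈p⇒x∈p∪⁅y⁆ : ∀ {p : Subset n} {x y} → x ∈ p → x ∈ p ∪ ⁅ y ⁆
x∈p⇒x∈p∪⁅y⁆ {y = y} = p⊆p∪q ⁅ y ⁆

x∉p⇒x∉p∪⁅y⁆ : ∀ {p : Subset n} {x y} → x ∉ p → y ≢ x → x ∉ p ∪ ⁅ y ⁆
x∉p⇒x∉p∪⁅y⁆ x∉p y≢x x∈ = x∉p (x∈p∪⁅y⁆⇒x∈p x∈ (≢-sym y≢x))

x∈p⇒x∈p-y : ∀ {p : Subset n} {x y} → x ∈ p → y ≢ x → x ∈ p - y
x∈p⇒x∈p-y x∈p y≢x = x∈p∧x≢y⇒x∈p-y x∈p (≢-sym y≢x)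

x∉p⇒x∉p-y : ∀ {p : Subset n} {x y} → x ∉ p → x ∉ p - y
x∉p⇒x∉p-y {p = p} {y = y} x∉p x∈ = x∉p (p─q⊆p p ⁅ y ⁆ x∈)

p⊆q⇒p∪⁅x⁆⊆q : ∀ {p q : Subset n} {x} → p ⊆ q → x ∈ q → p ∪ ⁅ x ⁆ ⊆ q
p⊆q⇒p∪⁅x⁆⊆q {p = p} {x = x} p⊆q x∈q {i} i∈ with x∈p∪q⁻ p ⁅ x ⁆ i∈
... | inj₁ i∈p = p⊆q i∈p
... | inj₂ i∈x = subst (_∈ _) (sym (x∈⁅y⁆⇒x≡y x i∈x)) x∈q

x∉p-x : ∀ (p : Subset n) x → x ∉ p - x
x∉p-x p x x∈ = x∈p─q⇒x∉q x∈ (x∈⁅x⁆ x)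

⁅⁆∩⁅⁆-empty : ∀ {a b : Fin n} → a ≢ b → Empty (⁅ a ⁆ ∩ ⁅ b ⁆)
⁅⁆∩⁅⁆-empty {a = a} {b} a≢b (i , i∈) with x∈p∩q⁻ ⁅ a ⁆ ⁅ b ⁆ i∈
... | i∈a , i∈b = a≢b (trans (sym (x∈⁅y⁆⇒x≡y a i∈a)) (x∈⁅y⁆⇒x≡y b i∈b))

∩⁅⁆-empty : ∀ {p : Subset n} {a} → a ∉ p → Empty (p ∩ ⁅ a ⁆)
∩⁅⁆-empty {p = p} {a} a∉p (i , i∈) with x∈p∩q⁻ p ⁅ a ⁆ i∈
... | i∈p , i∈a = a∉p (subst (_∈ p) (x∈⁅y⁆⇒x≡y a i∈a) i∈p)

⁅⁆─-empty : ∀ {p : Subset n} {a} → a ∈ p → Empty (⁅ a ⁆ ─ p)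
⁅⁆─-empty {p = p} {a} a∈p (i , i∈) =
  x∈p─q⇒x∉q i∈ (subst (_∈ p) (sym (x∈⁅y⁆⇒x≡y a (p─q⊆p ⁅ a ⁆ p i∈))) a∈p)

∪-empty : ∀ {p q : Subset n} → Empty p → Empty q → Empty (p ∪ q)
∪-empty {p = p} {q} p-empty q-empty (i , i∈) with x∈p∪q⁻ p q i∈
... | inj₁ i∈p = p-empty (i , i∈p)
... | inj₂ i∈q = q-empty (i , i∈q)

∅-empty : Empty (∅ {n})
∅-empty (_ , i∈∅) = ∉⊥ i∈∅

infixr 7 _∩ₑ_
infixr 6 _∪ₑ_
infixl 5 _─ₑ_

data SetExpr (k : ℕ) : Set where
  var : Fin k → SetExpr k
  ∅ₑ : SetExpr k
  _∪ₑ_ _∩ₑ_ _─ₑ_ : SetExpr k → SetExpr k → SetExpr k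

v₀ : SetExpr (suc k)
v₀ = var zero
v₁ : SetExpr (suc (suc k))
v₁ = var (suc zero)
v₂ : SetExpr (suc (suc (suc k)))
v₂ = var (suc (suc zero))
v₃ : SetExpr (suc (suc (suc (suc k))))
v₃ = var (suc (suc (suc zero)))
v₄ : SetExpr (suc (suc (suc (suc (suc k)))))
v₄ = var (suc (suc (suc (suc zero))))
v₅ : SetExpr (suc (suc (suc (suc (suc (suc k))))))
v₅ = var (suc (suc (suc (suc (suc zero)))))
⟦_⟧ : SetExpr k → Vec (Subset n) k → Subset n
⟦ var j ⟧ Γ = lookup Γ j
⟦ ∅ₑ ⟧ Γ = ∅
⟦ e ∪ₑ f ⟧ Γ = ⟦ e ⟧ Γ ∪ ⟦ f ⟧ Γ
⟦ e ∩ₑ f ⟧ Γ = ⟦ e ⟧ Γ ∩ ⟦ f ⟧ Γ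
⟦ e ─ₑ f ⟧ Γ = ⟦ e ⟧ Γ ─ ⟦ f ⟧ Γ

⟦_⟧ᵇ : SetExpr k → Vec Bool k → Bool
⟦ var j ⟧ᵇ v = lookup v j
⟦ ∅ₑ ⟧ᵇ v = false
⟦ e ∪ₑ f ⟧ᵇ v = ⟦ e ⟧ᵇ v ∨ ⟦ f ⟧ᵇ v
⟦ e ∩ₑ f ⟧ᵇ v = ⟦ e ⟧ᵇ v ∧ ⟦ f ⟧ᵇ v
⟦ e ─ₑ f ⟧ᵇ v = ⟦ e ⟧ᵇ v ∧ not (⟦ f ⟧ᵇ v)

column : Vec (Subset n) k → Fin n → Vec Bool k
column Γ i = map (λ S → lookup S i) Γ

lookup-⟦⟧ : ∀ (e : SetExpr k) (Γ : Vec (Subset n) k) i → lookup (⟦ e ⟧ Γ) i ≡ ⟦ e ⟧ᵇ (column Γ i)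
lookup-⟦⟧ (var j) Γ i = sym (lookup-map j (λ S → lookup S i) Γ)
lookup-⟦⟧ ∅ₑ Γ i = lookup-∅ i
lookup-⟦⟧ (e ∪ₑ f) Γ i = trans (lookup-∪ (⟦ e ⟧ Γ) (⟦ f ⟧ Γ) i) (cong₂ _∨_ (lookup-⟦⟧ e Γ i) (lookup-⟦⟧ f Γ i))
lookup-⟦⟧ (e ∩ₑ f) Γ i = trans (lookup-∩ (⟦ e ⟧ Γ) (⟦ f ⟧ Γ) i) (cong₂ _∧_ (lookup-⟦⟧ e Γ i) (lookup-⟦⟧ f Γ i))
lookup-⟦⟧ (e ─ₑ f) Γ i =
  trans (lookup-─ (⟦ e ⟧ Γ) (⟦ f ⟧ Γ) i) (cong₂ (λ a b → a ∧ not b) (lookup-⟦⟧ e Γ i) (lookup-⟦⟧ f Γ i))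

allValuations : ∀ k → (Vec Bool k → Bool) → Bool
allValuations zero P = P []
allValuations (suc k) P = allValuations k (λ v → P (true ∷ v)) ∧ allValuations k (λ v → P (false ∷ v))

allValuations-sound : ∀ k (P : Vec Bool k → Bool) → T (allValuations k P) → ∀ v → T (P v)
allValuations-sound zero P t [] = t
allValuations-sound (suc k) P t (true ∷ v) = allValuations-sound k _ (T-∧ˡ t) v
  where
  T-∧ˡ : ∀ {a b} → T (a ∧ b) → T a
  T-∧ˡ {true} _ = _
allValuations-sound (suc k) P t (false ∷ v) = allValuations-sound k _ (T-∧ʳ t) v
  where
  T-∧ʳ : ∀ {a b} → T (a ∧ b) → T b
  T-∧ʳ {true} t = t

indicator : Bool → ℕ
indicator true = 1
indicator false = 0

∣∣-pointwise-≤ : ∀ (A B C D : Subset n) →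
  (∀ i → indicator (lookup A i) + indicator (lookup B i) ≤ indicator (lookup C i) + indicator (lookup D i)) →
  ∣ A ∣ + ∣ B ∣ ≤ ∣ C ∣ + ∣ D ∣
∣∣-pointwise-≤ [] [] [] [] _ = z≤n
∣∣-pointwise-≤ (a ∷ A) (b ∷ B) (c ∷ C) (d ∷ D) le =
  subst₂ _≤_ (interchange a b A B) (interchange c d C D)
    (+-mono-≤ (le zero) (∣∣-pointwise-≤ A B C D (λ i → le (suc i))))
  where
  interchange : ∀ a b (A B : Subset n) →
    (indicator a + indicator b) + (∣ A ∣ + ∣ B ∣) ≡ ∣ a ∷ A ∣ + ∣ b ∷ B ∣
  interchange true true A B = cong suc (sym (+-suc ∣ A ∣ ∣ B ∣))
  interchange true false A B = refl
  interchange false true A B = sym (+-suc ∣ A ∣ ∣ B ∣)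
  interchange false false A B = refl

_⇒ᵇ_ : Bool → Bool → Bool
a ⇒ᵇ b = not a ∨ b

-- Inclusions and cardinality inequalities between Boolean combinations of the sets in Γ are checked
-- on all truth assignments to the k variables, skipping those that satisfy h, which denotes ∅.
module _ (Γ : Vec (Subset n) k) (h : SetExpr k) (h-empty : Empty (⟦ h ⟧ Γ)) where

  private
    valid-at : ∀ (P : Vec Bool k → Bool) → T (allValuations k (λ v → ⟦ h ⟧ᵇ v ∨ P v)) → ∀ i → T (P (column Γ i))
    valid-at P t i = subst (λ b → T (b ∨ P (column Γ i))) h-false (allValuations-sound k _ t (column Γ i))
      where
      h-false : ⟦ h ⟧ᵇ (column Γ i) ≡ false
      h-false = trans (sym (lookup-⟦⟧ h Γ i)) (∉⇒lookup (λ i∈h → h-empty (i , i∈h)))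

    modus-ponens : ∀ {a b} → a ≡ true → T (a ⇒ᵇ b) → b ≡ true
    modus-ponens {b = true} _ _ = refl
    modus-ponens {b = false} refl ()

  solve-⊆-given : ∀ (e f : SetExpr k) →
    {T (allValuations k λ v → ⟦ h ⟧ᵇ v ∨ (⟦ e ⟧ᵇ v ⇒ᵇ ⟦ f ⟧ᵇ v))} → ⟦ e ⟧ Γ ⊆ ⟦ f ⟧ Γ
  solve-⊆-given e f {t} {i} i∈e =
    lookup⇒[]= i (⟦ f ⟧ Γ) (trans (lookup-⟦⟧ f Γ i)
      (modus-ponens (trans (sym (lookup-⟦⟧ e Γ i)) ([]=⇒lookup i∈e)) (valid-at _ t i)))

  solve-≡-given : ∀ (e f : SetExpr k) →
    {T (allValuations k λ v → ⟦ h ⟧ᵇ v ∨ (⟦ e ⟧ᵇ v ⇒ᵇ ⟦ f ⟧ᵇ v))} →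
    {T (allValuations k λ v → ⟦ h ⟧ᵇ v ∨ (⟦ f ⟧ᵇ v ⇒ᵇ ⟦ e ⟧ᵇ v))} → ⟦ e ⟧ Γ ≡ ⟦ f ⟧ Γ
  solve-≡-given e f {t} {t′} = ⊆-antisym (solve-⊆-given e f {t}) (solve-⊆-given f e {t′})

  solve-∣∣-given : ∀ (a b c d : SetExpr k) →
    {T (allValuations k λ v → ⟦ h ⟧ᵇ v ∨
          (indicator (⟦ a ⟧ᵇ v) + indicator (⟦ b ⟧ᵇ v) ≤ᵇ indicator (⟦ c ⟧ᵇ v) + indicator (⟦ d ⟧ᵇ v)))} →
    ∣ ⟦ a ⟧ Γ ∣ + ∣ ⟦ b ⟧ Γ ∣ ≤ ∣ ⟦ c ⟧ Γ ∣ + ∣ ⟦ d ⟧ Γ ∣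
  solve-∣∣-given a b c d {t} = ∣∣-pointwise-≤ (⟦ a ⟧ Γ) (⟦ b ⟧ Γ) (⟦ c ⟧ Γ) (⟦ d ⟧ Γ) λ i →
    subst₂ _≤_ (cong₂ _+_ (ind-at a i) (ind-at b i)) (cong₂ _+_ (ind-at c i) (ind-at d i))
      (≤ᵇ⇒≤ _ _ (valid-at _ t i))
    where
    ind-at : ∀ e i → indicator (⟦ e ⟧ᵇ (column Γ i)) ≡ indicator (lookup (⟦ e ⟧ Γ) i)
    ind-at e i = cong indicator (sym (lookup-⟦⟧ e Γ i))

module _ (Γ : Vec (Subset n) k) where

  solve-⊆ : ∀ (e f : SetExpr k) → {T (allValuations k λ v → ⟦ e ⟧ᵇ v ⇒ᵇ ⟦ f ⟧ᵇ v)} → ⟦ e ⟧ Γ ⊆ ⟦ f ⟧ Γ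
  solve-⊆ e f {t} = solve-⊆-given Γ ∅ₑ ∅-empty e f {t}

  solve-≡ : ∀ (e f : SetExpr k) →
    {T (allValuations k λ v → ⟦ e ⟧ᵇ v ⇒ᵇ ⟦ f ⟧ᵇ v)} → {T (allValuations k λ v → ⟦ f ⟧ᵇ v ⇒ᵇ ⟦ e ⟧ᵇ v)} →
    ⟦ e ⟧ Γ ≡ ⟦ f ⟧ Γ
  solve-≡ e f {t} {t′} = solve-≡-given Γ ∅ₑ ∅-empty e f {t} {t′}

∪⁅⁆-swap : ∀ (p : Subset n) x y → (p ∪ ⁅ x ⁆) ∪ ⁅ y ⁆ ≡ (p ∪ ⁅ y ⁆) ∪ ⁅ x ⁆
∪⁅⁆-swap p x y = solve-≡ (p ∷ ⁅ x ⁆ ∷ ⁅ y ⁆ ∷ []) ((v₀ ∪ₑ v₁) ∪ₑ v₂) ((v₀ ∪ₑ v₂) ∪ₑ v₁)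

x∈p⇒p∪⁅x⁆≡p : ∀ {p : Subset n} {x} → x ∈ p → p ∪ ⁅ x ⁆ ≡ p
x∈p⇒p∪⁅x⁆≡p {p = p} {x} x∈p = solve-≡-given (p ∷ ⁅ x ⁆ ∷ []) (v₁ ─ₑ v₀) (⁅⁆─-empty x∈p) (v₀ ∪ₑ v₁) v₀

p⊆q⇒p-x⊆q-x : ∀ {p q : Subset n} x → p ⊆ q → p - x ⊆ q - x
p⊆q⇒p-x⊆q-x {p = p} {q} x p⊆q i∈ = x∈p∧x∉q⇒x∈p─q (p⊆q (p─q⊆p p ⁅ x ⁆ i∈)) (x∈p─q⇒x∉q i∈)

x∉p⇒p⊆q⇒p⊆q-x : ∀ {p q : Subset n} {x} → x ∉ p → p ⊆ q → p ⊆ q - x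
x∉p⇒p⊆q⇒p⊆q-x {x = x} x∉p p⊆q {i} i∈p =
  x∈p∧x∉q⇒x∈p─q (p⊆q i∈p) (λ i∈x → x∉p (subst (_∈ _) (x∈⁅y⁆⇒x≡y x i∈x) i∈p))

⊆⇒─-empty : ∀ {p q : Subset n} → p ⊆ q → Empty (p ─ q)
⊆⇒─-empty p⊆q (i , i∈p─q) = x∈p─q⇒x∉q i∈p─q (p⊆q (p─q⊆p _ _ i∈p─q))

p-x∪⁅x⁆≡p : ∀ {p : Subset n} {x} → x ∈ p → (p - x) ∪ ⁅ x ⁆ ≡ p
p-x∪⁅x⁆≡p {p = p} {x} x∈p = solve-≡-given (p ∷ ⁅ x ⁆ ∷ []) (v₁ ─ₑ v₀) (⁅⁆─-empty x∈p) ((v₀ ─ₑ v₁) ∪ₑ v₁) v₀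

p∪⁅x⁆-x≡p : ∀ {p : Subset n} {x} → x ∉ p → (p ∪ ⁅ x ⁆) - x ≡ p
p∪⁅x⁆-x≡p {p = p} {x} x∉p = solve-≡-given (p ∷ ⁅ x ⁆ ∷ []) (v₀ ∩ₑ v₁) (∩⁅⁆-empty x∉p) ((v₀ ∪ₑ v₁) ─ₑ v₁) v₀

swapElt-∪⁅⁆ : ∀ {p q e} (S : Subset n) → e ≢ p → swapElt q p (S ∪ ⁅ e ⁆) ≡ swapElt q p S ∪ ⁅ e ⁆
swapElt-∪⁅⁆ {p = p} {q} {e} S e≢p = solve-≡-given (S ∷ ⁅ p ⁆ ∷ ⁅ q ⁆ ∷ ⁅ e ⁆ ∷ []) (v₃ ∩ₑ v₁) (⁅⁆∩⁅⁆-empty e≢p)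
  (((v₀ ∪ₑ v₃) ─ₑ v₁) ∪ₑ v₂) (((v₀ ─ₑ v₁) ∪ₑ v₂) ∪ₑ v₃)

swapElt-─⁅⁆ : ∀ {p q e} (S : Subset n) → e ≢ q → swapElt q p (S - e) ≡ swapElt q p S - e
swapElt-─⁅⁆ {p = p} {q} {e} S e≢q = solve-≡-given (S ∷ ⁅ p ⁆ ∷ ⁅ q ⁆ ∷ ⁅ e ⁆ ∷ []) (v₃ ∩ₑ v₂) (⁅⁆∩⁅⁆-empty e≢q)
  (((v₀ ─ₑ v₃) ─ₑ v₁) ∪ₑ v₂) (((v₀ ─ₑ v₁) ∪ₑ v₂) ─ₑ v₃)

swapElt-∪⁅⁆-same : ∀ {p} q {S : Subset n} → p ∉ S → swapElt q p (S ∪ ⁅ p ⁆) ≡ S ∪ ⁅ q ⁆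
swapElt-∪⁅⁆-same {p = p} q {S} p∉S = cong (_∪ ⁅ q ⁆) (p∪⁅x⁆-x≡p p∉S)

swapElt-involutive : ∀ {p q} {S : Subset n} → p ∈ S → q ∉ S → swapElt p q (swapElt q p S) ≡ S
swapElt-involutive {p = p} {q} {S} p∈S q∉S = solve-≡-given (S ∷ ⁅ p ⁆ ∷ ⁅ q ⁆ ∷ []) ((v₁ ─ₑ v₀) ∪ₑ (v₀ ∩ₑ v₂))
  (∪-empty (⁅⁆─-empty p∈S) (∩⁅⁆-empty q∉S)) ((((v₀ ─ₑ v₁) ∪ₑ v₂) ─ₑ v₂) ∪ₑ v₁) v₀

q∈swapElt-q-p : ∀ {p q} (S : Subset n) → q ∈ swapElt q p S
q∈swapElt-q-p {q = q} S = x∈p∪⁅x⁆ _ q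

p∉swapElt-q-p : ∀ {p q} (S : Subset n) → p ≢ q → p ∉ swapElt q p S
p∉swapElt-q-p {p = p} S p≢q = x∉p⇒x∉p∪⁅y⁆ (x∉p-x S p) (≢-sym p≢q)

x∈swapElt⁺ : ∀ {p q x} {S : Subset n} → x ∈ S → x ≢ p → x ∈ swapElt q p S
x∈swapElt⁺ {p = p} {q} {S = S} x∈S x≢p = p⊆p∪q ⁅ q ⁆ (x∈p∧x≢y⇒x∈p-y x∈S x≢p)

x∈swapElt⁻ : ∀ {p q x} {S : Subset n} → x ∈ swapElt q p S → x ≢ q → x ∈ S
x∈swapElt⁻ {p = p} {S = S} x∈ x≢q = p─q⊆p S ⁅ p ⁆ (x∈p∪⁅y⁆⇒x∈p x∈ x≢q)

swapElt-─⁅⁆-both : ∀ {p q} {A : Subset n} → p ∈ A → p ≢ q → swapElt p q (A - p) ≡ A - q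
swapElt-─⁅⁆-both {p = p} {q} {A} p∈A p≢q = solve-≡-given (A ∷ ⁅ p ⁆ ∷ ⁅ q ⁆ ∷ []) ((v₁ ─ₑ v₀) ∪ₑ (v₁ ∩ₑ v₂))
  (∪-empty (⁅⁆─-empty p∈A) (⁅⁆∩⁅⁆-empty p≢q)) (((v₀ ─ₑ v₁) ─ₑ v₂) ∪ₑ v₁) (v₀ ─ₑ v₂)

swapElt-mono : ∀ {p q} {S T : Subset n} → S ⊆ T → swapElt q p S ⊆ swapElt q p T
swapElt-mono {p = p} {q} {T = T} S⊆T =
  p⊆q⇒p∪⁅x⁆⊆q (λ i∈ → p⊆p∪q ⁅ q ⁆ (p⊆q⇒p-x⊆q-x p S⊆T i∈)) (x∈p∪⁅x⁆ (T - p) q)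

∣swapElt∣ : ∀ {p q} {S : Subset n} → p ∈ S → q ∉ S → ∣ swapElt q p S ∣ ≡ ∣ S ∣
∣swapElt∣ {n = n} {p = p} {q} {S} p∈S q∉S = +-cancelʳ-≡ 1 _ _ (begin
  ∣ swapElt q p S ∣ + 1           ≡⟨ cong (∣ swapElt q p S ∣ +_) (∣⁅x⁆∣≡1 p) ⟨
  ∣ swapElt q p S ∣ + ∣ ⁅ p ⁆ ∣   ≡⟨ ≤-antisym (solve-∣∣-given Γ 𝒉 𝒉-empty 𝑺′ 𝒑 𝑺 𝒒) (solve-∣∣-given Γ 𝒉 𝒉-empty 𝑺 𝒒 𝑺′ 𝒑) ⟩
  ∣ S ∣ + ∣ ⁅ q ⁆ ∣               ≡⟨ cong (∣ S ∣ +_) (∣⁅x⁆∣≡1 q) ⟩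
  ∣ S ∣ + 1                       ∎)
  where
  open ≡-Reasoning
  Γ : Vec (Subset n) 3
  Γ = S ∷ ⁅ p ⁆ ∷ ⁅ q ⁆ ∷ []
  𝑺 𝒑 𝒒 𝑺′ : SetExpr 3
  𝑺 = v₀
  𝒑 = v₁
  𝒒 = v₂
  𝑺′ = (𝑺 ─ₑ 𝒑) ∪ₑ 𝒒
  𝒉 : SetExpr 3
  𝒉 = (𝒑 ─ₑ 𝑺) ∪ₑ (𝑺 ∩ₑ 𝒒)
  𝒉-empty : Empty (⟦ 𝒉 ⟧ Γ)
  𝒉-empty = ∪-empty (⁅⁆─-empty p∈S) (∩⁅⁆-empty q∉S)

≤-via-≡ : ∀ {a a′ b b′ : ℕ} → a ≡ a′ → b ≡ b′ → a′ ≤ b′ → a ≤ b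
≤-via-≡ refl refl le = le

+≤+-via-≡ : ∀ {a a′ b b′ c c′ d d′ : ℕ} → a ≡ a′ → b ≡ b′ → c ≡ c′ → d ≡ d′ → a′ + b′ ≤ c′ + d′ → a + b ≤ c + d
+≤+-via-≡ refl refl refl refl le = le

<-via-≡ : ∀ {a a′ b b′ : ℕ} → a ≡ a′ → b ≡ b′ → a′ < b′ → a < b
<-via-≡ refl refl lt = lt

+-telescope-≤ : ∀ w x y z u v → w + x ≤ y + z → y + u ≤ x + v → w + u ≤ z + v
+-telescope-≤ w x y z u v p q = +-cancelʳ-≤ (x + y) (w + u) (z + v) (begin
  (w + u) + (x + y) ≡⟨ regroup₁ w x y u ⟩
  (w + x) + (y + u) ≤⟨ +-mono-≤ p q ⟩
  (y + z) + (x + v) ≡⟨ regroup₂ x y z v ⟩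
  (z + v) + (x + y) ∎)
  where
  open ≤-Reasoning
  regroup₁ : ∀ w x y u → (w + u) + (x + y) ≡ (w + x) + (y + u)
  regroup₁ = solve-∀
  regroup₂ : ∀ x y z v → (y + z) + (x + v) ≡ (z + v) + (x + y)
  regroup₂ = solve-∀

⊓+≤+⊓ : ∀ p q p′ q′ c d → p + c ≤ d + p′ → q + c ≤ d + q′ → (p ⊓ q) + c ≤ d + (p′ ⊓ q′)
⊓+≤+⊓ p q p′ q′ c d le₁ le₂ = begin
  (p ⊓ q) + c         ≡⟨ +-distribʳ-⊓ c p q ⟩
  (p + c) ⊓ (q + c)   ≤⟨ ⊓-mono-≤ le₁ le₂ ⟩
  (d + p′) ⊓ (d + q′) ≡⟨ +-distribˡ-⊓ d p′ q′ ⟨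
  d + (p′ ⊓ q′)       ∎
  where open ≤-Reasoning

+⊓≤⊓+ : ∀ p q p′ q′ c d → c + p ≤ p′ + d → c + q ≤ q′ + d → c + (p ⊓ q) ≤ (p′ ⊓ q′) + d
+⊓≤⊓+ p q p′ q′ c d le₁ le₂ = begin
  c + (p ⊓ q)         ≡⟨ +-distribˡ-⊓ c p q ⟩
  (c + p) ⊓ (c + q)   ≤⟨ ⊓-mono-≤ le₁ le₂ ⟩
  (p′ + d) ⊓ (q′ + d) ≡⟨ +-distribʳ-⊓ d p′ q′ ⟨
  (p′ ⊓ q′) + d       ∎
  where open ≤-Reasoning

⊓+⊔≡+ : ∀ p q → (p ⊓ q) + (p ⊔ q) ≡ p + q
⊓+⊔≡+ p q with ≤-total p q
... | inj₁ p≤q rewrite m≤n⇒m⊓n≡m p≤q | m≤n⇒m⊔n≡n p≤q = refl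
... | inj₂ q≤p rewrite m≥n⇒m⊓n≡n q≤p | m≥n⇒m⊔n≡m q≤p = +-comm q p

⊓-submodular : ∀ u₀ u₁ u₂ u₁₂ v₀ v₁ v₂ v₁₂ →
  u₁₂ + u₀ ≤ u₁ + u₂ → v₁₂ + v₀ ≤ v₁ + v₂ →
  (u₁₂ ⊓ v₁₂) + (u₀ ⊓ v₀) ≤ u₁ + v₂ → (u₁₂ ⊓ v₁₂) + (u₀ ⊓ v₀) ≤ v₁ + u₂ →
  (u₁₂ ⊓ v₁₂) + (u₀ ⊓ v₀) ≤ (u₁ ⊓ v₁) + (u₂ ⊓ v₂)
⊓-submodular u₀ u₁ u₂ u₁₂ v₀ v₁ v₂ v₁₂ u-sub v-sub uv vu = begin
  (u₁₂ ⊓ v₁₂) + (u₀ ⊓ v₀)                              ≤⟨ ⊓-glb (⊓-glb uu uv) (⊓-glb vu vv) ⟩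
  ((u₁ + u₂) ⊓ (u₁ + v₂)) ⊓ ((v₁ + u₂) ⊓ (v₁ + v₂))    ≡⟨ cong₂ _⊓_ (+-distribˡ-⊓ u₁ u₂ v₂) (+-distribˡ-⊓ v₁ u₂ v₂) ⟨
  (u₁ + (u₂ ⊓ v₂)) ⊓ (v₁ + (u₂ ⊓ v₂))                  ≡⟨ +-distribʳ-⊓ (u₂ ⊓ v₂) u₁ v₁ ⟨
  (u₁ ⊓ v₁) + (u₂ ⊓ v₂)                                ∎
  where
  open ≤-Reasoning
  uu : (u₁₂ ⊓ v₁₂) + (u₀ ⊓ v₀) ≤ u₁ + u₂
  uu = ≤-trans (+-mono-≤ (m⊓n≤m u₁₂ v₁₂) (m⊓n≤m u₀ v₀)) u-sub
  vv : (u₁₂ ⊓ v₁₂) + (u₀ ⊓ v₀) ≤ v₁ + v₂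
  vv = ≤-trans (+-mono-≤ (m⊓n≤n u₁₂ v₁₂) (m⊓n≤n u₀ v₀)) v-sub

⊓-submodular-uncrossed : ∀ u₀ u₁ u₂ u₁₂ v₀ v₁ v₂ v₁₂ →
  u₁₂ + u₀ ≤ u₁ + u₂ → v₁₂ + v₀ ≤ v₁ + v₂ →
  ¬ (u₁ < v₁ × v₂ < u₂) → ¬ (v₁ < u₁ × u₂ < v₂) →
  (u₁₂ ⊓ v₁₂) + (u₀ ⊓ v₀) ≤ (u₁ ⊓ v₁) + (u₂ ⊓ v₂)
⊓-submodular-uncrossed u₀ u₁ u₂ u₁₂ v₀ v₁ v₂ v₁₂ u-sub v-sub no-uv no-vu =
  ⊓-submodular u₀ u₁ u₂ u₁₂ v₀ v₁ v₂ v₁₂ u-sub v-sub (mixed u₀ u₁ u₂ u₁₂ v₀ v₁ v₂ v₁₂ u-sub v-sub no-uv)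
    (subst₂ (λ a b → a + b ≤ v₁ + u₂) (⊓-comm v₁₂ u₁₂) (⊓-comm v₀ u₀)
      (mixed v₀ v₁ v₂ v₁₂ u₀ u₁ u₂ u₁₂ v-sub u-sub no-vu))
  where
  mixed : ∀ u₀ u₁ u₂ u₁₂ v₀ v₁ v₂ v₁₂ → u₁₂ + u₀ ≤ u₁ + u₂ → v₁₂ + v₀ ≤ v₁ + v₂ → ¬ (u₁ < v₁ × v₂ < u₂) →
    (u₁₂ ⊓ v₁₂) + (u₀ ⊓ v₀) ≤ u₁ + v₂
  mixed u₀ u₁ u₂ u₁₂ v₀ v₁ v₂ v₁₂ u-sub v-sub no-uv with u₁ <? v₁ | v₂ <? u₂
  ... | yes u₁<v₁ | yes v₂<u₂ = ⊥-elim (no-uv (u₁<v₁ , v₂<u₂))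
  ... | no u₁≮v₁ | _ = ≤-trans (+-mono-≤ (m⊓n≤n u₁₂ v₁₂) (m⊓n≤n u₀ v₀)) (≤-trans v-sub (+-monoˡ-≤ v₂ (≮⇒≥ u₁≮v₁)))
  ... | yes _ | no v₂≮u₂ = ≤-trans (+-mono-≤ (m⊓n≤m u₁₂ v₁₂) (m⊓n≤m u₀ v₀)) (≤-trans u-sub (+-monoʳ-≤ u₁ (≮⇒≥ v₂≮u₂)))

-- Submodularity from local submodularity

⊆-induction : ∀ {ℓ} (P : Subset n → Set ℓ) {A B : Subset n} → A ⊆ B → P A →
  (∀ {C} e → A ⊆ C → C ⊆ B → e ∈ B → e ∉ C → P C → P (C ∪ ⁅ e ⁆)) → P B
⊆-induction {n = n} P {A} {B} A⊆B PA step = grow ⊆-refl A⊆B PA (<-wellFounded ∣ B ─ A ∣)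
  where
  grow : ∀ {C} → A ⊆ C → C ⊆ B → P C → Acc _<_ ∣ B ─ C ∣ → P B
  grow {C} A⊆C C⊆B PC (acc rec) with nonempty? (B ─ C)
  ... | no B─C-empty = subst P (⊆-antisym C⊆B B⊆C) PC
    where
    B⊆C : B ⊆ C
    B⊆C = solve-⊆-given (B ∷ C ∷ []) (v₀ ─ₑ v₁) B─C-empty v₀ v₁
  ... | yes (e , e∈B─C) =
    grow (⊆-trans A⊆C (p⊆p∪q ⁅ e ⁆)) C∪e⊆B (step e A⊆C C⊆B e∈B e∉C PC) (rec shrinks)
    where
    e∈B : e ∈ B
    e∈B = p─q⊆p B C e∈B─C
    e∉C : e ∉ C
    e∉C = x∈p─q⇒x∉q e∈B─C
    C∪e⊆B : C ∪ ⁅ e ⁆ ⊆ B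
    C∪e⊆B = p⊆q⇒p∪⁅x⁆⊆q C⊆B e∈B
    shrinks : ∣ B ─ (C ∪ ⁅ e ⁆) ∣ < ∣ B ─ C ∣
    shrinks = subst (λ S → ∣ S ∣ < ∣ B ─ C ∣) (solve-≡ (B ∷ C ∷ ⁅ e ⁆ ∷ []) (v₀ ─ₑ v₁ ─ₑ v₂) (v₀ ─ₑ (v₁ ∪ₑ v₂)))
      (x∈p⇒∣p-x∣<∣p∣ e∈B─C)

module _ (f : Subset n → ℕ) where

  LocallySubmodularAt : Subset n → Fin n → Fin n → Set
  LocallySubmodularAt X a b = f ((X ∪ ⁅ a ⁆) ∪ ⁅ b ⁆) + f X ≤ f (X ∪ ⁅ a ⁆) + f (X ∪ ⁅ b ⁆)

  locallySubmodularAt-sym : ∀ {X a b} → LocallySubmodularAt X b a → LocallySubmodularAt X a b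
  locallySubmodularAt-sym {X} {a} {b} le = subst₂ _≤_
    (cong (λ S → f S + f X) (∪⁅⁆-swap X b a)) (+-comm (f (X ∪ ⁅ b ⁆)) (f (X ∪ ⁅ a ⁆))) le

  LocallySubmodular : Set
  LocallySubmodular = ∀ X a b → a ∉ X → b ∉ X → a ≢ b → LocallySubmodularAt X a b

  module _ (local : LocallySubmodular) where

    locallySubmodular⇒diminishing : ∀ {A B} e → A ⊆ B → e ∉ B → f (B ∪ ⁅ e ⁆) + f A ≤ f B + f (A ∪ ⁅ e ⁆)
    locallySubmodular⇒diminishing {A} {B} e A⊆B = ⊆-induction P A⊆B base step
      where
      P : Subset n → Set
      P C = e ∉ C → f (C ∪ ⁅ e ⁆) + f A ≤ f C + f (A ∪ ⁅ e ⁆)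
      base : P A
      base _ = ≤-reflexive (+-comm (f (A ∪ ⁅ e ⁆)) (f A))
      step : ∀ {C} b → A ⊆ C → C ⊆ B → b ∈ B → b ∉ C → P C → P (C ∪ ⁅ b ⁆)
      step {C} b _ _ _ b∉C ih e∉C∪b = +-telescope-≤ _ (f C) (f (C ∪ ⁅ e ⁆)) _ (f A) (f (A ∪ ⁅ e ⁆))
        (subst (λ S → f S + f C ≤ f (C ∪ ⁅ e ⁆) + f (C ∪ ⁅ b ⁆)) (∪⁅⁆-swap C e b)
          (local C e b e∉C b∉C e≢b))
        (ih e∉C)
        where
        e∉C : e ∉ C
        e∉C e∈C = e∉C∪b (p⊆p∪q ⁅ b ⁆ e∈C)
        e≢b : e ≢ b
        e≢b refl = e∉C∪b (x∈p∪⁅x⁆ C b)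

    locallySubmodular⇒submodular : ∀ X Y → f (X ∪ Y) + f (X ∩ Y) ≤ f X + f Y
    locallySubmodular⇒submodular X Y = ⊆-induction P (p∩q⊆q X Y) base step
      where
      P : Subset n → Set
      P Z = f (X ∪ Z) + f (X ∩ Z) ≤ f X + f Z
      base : P (X ∩ Y)
      base = ≤-reflexive (cong₂ (λ S S′ → f S + f S′)
        (solve-≡ (X ∷ Y ∷ []) (v₀ ∪ₑ v₀ ∩ₑ v₁) v₀) (solve-≡ (X ∷ Y ∷ []) (v₀ ∩ₑ v₀ ∩ₑ v₁) (v₀ ∩ₑ v₁)))
      step : ∀ {C} e → X ∩ Y ⊆ C → C ⊆ Y → e ∈ Y → e ∉ C → P C → P (C ∪ ⁅ e ⁆)
      step {C} e X∩Y⊆C _ e∈Y e∉C ih = begin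
        f (X ∪ (C ∪ ⁅ e ⁆)) + f (X ∩ (C ∪ ⁅ e ⁆))
          ≡⟨ cong₂ (λ S S′ → f S + f S′)
               (solve-≡ (X ∷ C ∷ ⁅ e ⁆ ∷ []) (v₀ ∪ₑ v₁ ∪ₑ v₂) ((v₀ ∪ₑ v₁) ∪ₑ v₂))
               (solve-≡-given (X ∷ C ∷ ⁅ e ⁆ ∷ []) (v₀ ∩ₑ v₂) (∩⁅⁆-empty e∉X) (v₀ ∩ₑ (v₁ ∪ₑ v₂)) (v₀ ∩ₑ v₁)) ⟩
        f ((X ∪ C) ∪ ⁅ e ⁆) + f (X ∩ C)
          ≤⟨ +-telescope-≤ _ (f C) (f (X ∪ C)) _ (f (X ∩ C)) (f X)
               (locallySubmodular⇒diminishing e (q⊆p∪q X C) e∉X∪C)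
               (≤-trans ih (≤-reflexive (+-comm (f X) (f C)))) ⟩
        f (C ∪ ⁅ e ⁆) + f X
          ≡⟨ +-comm (f (C ∪ ⁅ e ⁆)) (f X) ⟩
        f X + f (C ∪ ⁅ e ⁆) ∎
        where
        open ≤-Reasoning
        e∉X : e ∉ X
        e∉X e∈X = e∉C (X∩Y⊆C (x∈p∩q⁺ (e∈X , e∈Y)))
        e∉X∪C : e ∉ X ∪ C
        e∉X∪C e∈ with x∈p∪q⁻ X C e∈
        ... | inj₁ e∈X = e∉X e∈X
        ... | inj₂ e∈C = e∉C e∈C

  locallyMonotone⇒monotone : (∀ X e → f X ≤ f (X ∪ ⁅ e ⁆)) → ∀ {A B} → A ⊆ B → f A ≤ f B
  locallyMonotone⇒monotone inc {A} A⊆B =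
    ⊆-induction (λ C → f A ≤ f C) A⊆B ≤-refl (λ {C} e _ _ _ _ le → ≤-trans le (inc C e))

suc∘-locallySubmodularAt : ∀ (f : Subset n → ℕ) {X a b} → LocallySubmodularAt f X a b →
  LocallySubmodularAt (λ S → suc (f S)) X a b
suc∘-locallySubmodularAt f {X} {a} {b} le = subst₂ _≤_ (sym (+-suc (suc (f ((X ∪ ⁅ a ⁆) ∪ ⁅ b ⁆))) (f X)))
  (sym (+-suc (suc (f (X ∪ ⁅ a ⁆))) (f (X ∪ ⁅ b ⁆)))) (s≤s (s≤s le))

+-suc-≤ : ∀ a b c d → a + b ≤ c + d → a + suc b ≤ suc c + d
+-suc-≤ a b c d le = subst (_≤ suc c + d) (sym (+-suc a b)) (s≤s le)

-- Rank functions

NonModularSeparations : Matroid n → Fin n → Fin n → Set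
NonModularSeparations M x y = ∀ X Y → InZdiff M x y X → InZdiff M y x Y → ¬ Modular M X Y

modular-sym : ∀ {M : Matroid n} {X Y} → Modular M X Y → Modular M Y X
modular-sym {M = M} {X} {Y} modular =
  trans (+-comm (r M Y) (r M X)) (trans modular (cong₂ (λ U V → r M U + r M V) (∪-comm X Y) (∩-comm X Y)))

nonModularSeparations-sym : ∀ {M : Matroid n} {x y} → NonModularSeparations M x y → NonModularSeparations M y x
nonModularSeparations-sym {M = M} nonModular X Y yxX xyY modular = nonModular Y X xyY yxX (modular-sym {M = M} modular)

module MatroidProperties {n : ℕ} (M : Matroid n) where

  private
    ρ : Subset n → ℕ
    ρ = r M

  rank-mono : ∀ {A B} → A ⊆ B → ρ A ≤ ρ B
  rank-mono {A} {B} = r-mono M A B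

  rank-submodular⊆ : ∀ {A B C D} → C ⊆ A ∪ B → D ⊆ A ∩ B → ρ C + ρ D ≤ ρ A + ρ B
  rank-submodular⊆ {A} {B} C⊆ D⊆ = ≤-trans (+-mono-≤ (rank-mono C⊆) (rank-mono D⊆)) (r-submod M A B)

  rank-submodular-given : ∀ {k} (Γ : Vec (Subset n) k) h → Empty (⟦ h ⟧ Γ) → ∀ c d a b →
    {T (allValuations k λ v → ⟦ h ⟧ᵇ v ∨ (⟦ c ⟧ᵇ v ⇒ᵇ ⟦ a ∪ₑ b ⟧ᵇ v))} →
    {T (allValuations k λ v → ⟦ h ⟧ᵇ v ∨ (⟦ d ⟧ᵇ v ⇒ᵇ ⟦ a ∩ₑ b ⟧ᵇ v))} →
    ρ (⟦ c ⟧ Γ) + ρ (⟦ d ⟧ Γ) ≤ ρ (⟦ a ⟧ Γ) + ρ (⟦ b ⟧ Γ)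
  rank-submodular-given Γ h h-empty c d a b {t₁} {t₂} =
    rank-submodular⊆ (solve-⊆-given Γ h h-empty c (a ∪ₑ b) {t₁}) (solve-⊆-given Γ h h-empty d (a ∩ₑ b) {t₂})

  rank-≤-∪⁅⁆ : ∀ A e → ρ A ≤ ρ (A ∪ ⁅ e ⁆)
  rank-≤-∪⁅⁆ A e = rank-mono (p⊆p∪q ⁅ e ⁆)

  rank-∪⁅⁆≤suc : ∀ A e → ρ (A ∪ ⁅ e ⁆) ≤ suc (ρ A)
  rank-∪⁅⁆≤suc A e = +-cancelʳ-≤ (ρ (A ∩ ⁅ e ⁆)) _ _ (begin
    ρ (A ∪ ⁅ e ⁆) + ρ (A ∩ ⁅ e ⁆) ≤⟨ r-submod M A ⁅ e ⁆ ⟩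
    ρ A + ρ ⁅ e ⁆                 ≤⟨ +-monoʳ-≤ (ρ A) (subst (ρ ⁅ e ⁆ ≤_) (∣⁅x⁆∣≡1 e) (r-bound M ⁅ e ⁆)) ⟩
    ρ A + 1                       ≡⟨ +-comm (ρ A) 1 ⟩
    suc (ρ A)                     ≤⟨ m≤m+n (suc (ρ A)) _ ⟩
    suc (ρ A) + ρ (A ∩ ⁅ e ⁆)     ∎)
    where open ≤-Reasoning

  rank-─⁅⁆≤ : ∀ A e → ρ (A - e) ≤ ρ A
  rank-─⁅⁆≤ A e = rank-mono (p─q⊆p A ⁅ e ⁆)

  rank-≤suc-─⁅⁆ : ∀ A e → ρ A ≤ suc (ρ (A - e))
  rank-≤suc-─⁅⁆ A e =
    ≤-trans (rank-mono (solve-⊆ (A ∷ ⁅ e ⁆ ∷ []) v₀ ((v₀ ─ₑ v₁) ∪ₑ v₁))) (rank-∪⁅⁆≤suc (A - e) e)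

  rank-diminishing : ∀ {A B} e → A ⊆ B → ρ (B ∪ ⁅ e ⁆) + ρ A ≤ ρ B + ρ (A ∪ ⁅ e ⁆)
  rank-diminishing {A} {B} e A⊆B = rank-submodular⊆
    (solve-⊆ (B ∷ A ∷ ⁅ e ⁆ ∷ []) (v₀ ∪ₑ v₂) (v₀ ∪ₑ v₁ ∪ₑ v₂))
    (λ a∈A → x∈p∩q⁺ (A⊆B a∈A , p⊆p∪q ⁅ e ⁆ a∈A))

  rank-locallySubmodularAt : ∀ X a b → LocallySubmodularAt ρ X a b
  rank-locallySubmodularAt X a b = rank-submodular⊆
    (solve-⊆ (X ∷ ⁅ a ⁆ ∷ ⁅ b ⁆ ∷ []) ((v₀ ∪ₑ v₁) ∪ₑ v₂) ((v₀ ∪ₑ v₁) ∪ₑ (v₀ ∪ₑ v₂)))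
    (solve-⊆ (X ∷ ⁅ a ⁆ ∷ ⁅ b ⁆ ∷ []) v₀ ((v₀ ∪ₑ v₁) ∩ₑ (v₀ ∪ₑ v₂)))

  rank-≤-rank+∣─∣ : ∀ S G → ρ S ≤ ρ G + ∣ S ─ G ∣
  rank-≤-rank+∣─∣ S G = begin
    ρ S                             ≤⟨ rank-mono (solve-⊆ (S ∷ G ∷ []) v₀ (v₁ ∪ₑ (v₀ ─ₑ v₁))) ⟩
    ρ (G ∪ (S ─ G))                   ≤⟨ m≤m+n _ _ ⟩
    ρ (G ∪ (S ─ G)) + ρ (G ∩ (S ─ G))   ≤⟨ r-submod M G (S ─ G) ⟩
    ρ G + ρ (S ─ G)                 ≤⟨ +-monoʳ-≤ (ρ G) (r-bound M (S ─ G)) ⟩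
    ρ G + ∣ S ─ G ∣                 ∎
    where open ≤-Reasoning

  rank-∪⁅⁆-⊔ : ∀ T a b → ρ (T ∪ ⁅ a ⁆) ⊔ ρ (T ∪ ⁅ b ⁆) ≡ suc (ρ T) ⊓ ρ ((T ∪ ⁅ a ⁆) ∪ ⁅ b ⁆)
  rank-∪⁅⁆-⊔ T a b = ≤-antisym
    (⊔-lub (⊓-glb (rank-∪⁅⁆≤suc T a) (rank-≤-∪⁅⁆ (T ∪ ⁅ a ⁆) b))
           (⊓-glb (rank-∪⁅⁆≤suc T b) (subst (λ S → ρ (T ∪ ⁅ b ⁆) ≤ ρ S) (∪⁅⁆-swap T b a) (rank-≤-∪⁅⁆ (T ∪ ⁅ b ⁆) a))))
    lower
    where
    lower : suc (ρ T) ⊓ ρ ((T ∪ ⁅ a ⁆) ∪ ⁅ b ⁆) ≤ ρ (T ∪ ⁅ a ⁆) ⊔ ρ (T ∪ ⁅ b ⁆)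
    lower with ρ (T ∪ ⁅ a ⁆) ≟ suc (ρ T)
    ... | yes a-independent = ≤-trans (m⊓n≤m _ _) (≤-trans (≤-reflexive (sym a-independent)) (m≤m⊔n _ _))
    ... | no a-dependent = ≤-trans (m⊓n≤n _ _) (≤-trans Tab≤Tb (m≤n⊔m _ _))
      where
      Ta≡T : ρ (T ∪ ⁅ a ⁆) ≡ ρ T
      Ta≡T = ≤-antisym (≤-pred (≤∧≢⇒< (rank-∪⁅⁆≤suc T a) a-dependent)) (rank-≤-∪⁅⁆ T a)
      Tab≤Tb : ρ ((T ∪ ⁅ a ⁆) ∪ ⁅ b ⁆) ≤ ρ (T ∪ ⁅ b ⁆)
      Tab≤Tb = +-cancelʳ-≤ (ρ T) _ _ (subst₂ (λ S k → ρ S + ρ T ≤ ρ (T ∪ ⁅ b ⁆) + k) (∪⁅⁆-swap T b a) Ta≡T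
        (rank-diminishing a (p⊆p∪q ⁅ b ⁆)))

  closure : Subset n → Subset n
  closure A = tabulate λ e → ρ (A ∪ ⁅ e ⁆) ≡ᵇ ρ A

  ∈closure⇒ : ∀ {A e} → e ∈ closure A → ρ (A ∪ ⁅ e ⁆) ≡ ρ A
  ∈closure⇒ {A} {e} e∈ =
    ≡ᵇ⇒≡ _ _ (Equivalence.from T-≡ (trans (sym (lookup∘tabulate _ e)) ([]=⇒lookup e∈)))

  ⇒∈closure : ∀ {A e} → ρ (A ∪ ⁅ e ⁆) ≡ ρ A → e ∈ closure A
  ⇒∈closure {A} {e} eq =
    lookup⇒[]= e (closure A) (trans (lookup∘tabulate _ e) (Equivalence.to T-≡ (≡⇒≡ᵇ _ _ eq)))

  ⊆closure : ∀ A → A ⊆ closure A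
  ⊆closure A e∈A = ⇒∈closure (cong ρ (x∈p⇒p∪⁅x⁆≡p e∈A))

  rank-closure : ∀ A → ρ (closure A) ≡ ρ A
  rank-closure A = ≤-antisym (⊆-induction (λ C → ρ C ≤ ρ A) (⊆closure A) ≤-refl step) (rank-mono (⊆closure A))
    where
    step : ∀ {C} e → A ⊆ C → C ⊆ closure A → e ∈ closure A → e ∉ C → ρ C ≤ ρ A → ρ (C ∪ ⁅ e ⁆) ≤ ρ A
    step {C} e A⊆C _ e∈cl _ C≤A = ≤-trans (+-cancelʳ-≤ (ρ A) _ _ C∪e+A≤C+A) C≤A
      where
      C∪e+A≤C+A : ρ (C ∪ ⁅ e ⁆) + ρ A ≤ ρ C + ρ A
      C∪e+A≤C+A = subst (λ k → ρ (C ∪ ⁅ e ⁆) + ρ A ≤ ρ C + k) (∈closure⇒ e∈cl) (rank-diminishing e A⊆C)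

  closure-flat : ∀ A → Flat M (closure A)
  closure-flat A e e∉cl = begin-strict
    ρ (closure A)           ≡⟨ rank-closure A ⟩
    ρ A                     <⟨ ≤∧≢⇒< (rank-≤-∪⁅⁆ A e) (λ eq → e∉cl (⇒∈closure (sym eq))) ⟩
    ρ (A ∪ ⁅ e ⁆)           ≤⟨ rank-mono (p⊆q⇒p∪⁅x⁆⊆q (⊆-trans (⊆closure A) (p⊆p∪q ⁅ e ⁆)) (x∈p∪⁅x⁆ _ e)) ⟩
    ρ (closure A ∪ ⁅ e ⁆)   ∎
    where open ≤-Reasoning

  closure-noColoops : ∀ A → NoColoops M A → NoColoops M (closure A)
  closure-noColoops A noColoops e _ = ≤-antisym (rank-─⁅⁆≤ (closure A) e) (begin
    ρ (closure A)     ≡⟨ rank-closure A ⟩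
    ρ A               ≤⟨ ρA≤ρ[A-e] ⟩
    ρ (closure A - e) ∎)
    where
    open ≤-Reasoning
    ρA≤ρ[A-e] : ρ A ≤ ρ (closure A - e)
    ρA≤ρ[A-e] with e ∈? A
    ... | yes e∈A = ≤-trans (≤-reflexive (sym (noColoops e e∈A))) (rank-mono (p⊆q⇒p-x⊆q-x e (⊆closure A)))
    ... | no e∉A = rank-mono (x∉p⇒p⊆q⇒p⊆q-x e∉A (⊆closure A))

  coloopFree-part : ∀ S → ∃ λ A → A ⊆ S × NoColoops M A × ρ A + ∣ S ─ A ∣ ≤ ρ S
  coloopFree-part S = go S (<-wellFounded ∣ S ∣)
    where
    ∣─∣≤suc∣-─∣ : ∀ S A e → ∣ S ─ A ∣ ≤ suc ∣ S - e ─ A ∣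
    ∣─∣≤suc∣-─∣ S A e = begin
      ∣ S ─ A ∣                   ≡⟨ +-identityʳ _ ⟨
      ∣ S ─ A ∣ + 0               ≡⟨ cong (∣ S ─ A ∣ +_) (∣⊥∣≡0 n) ⟨
      ∣ S ─ A ∣ + ∣ ∅ {n} ∣       ≤⟨ solve-∣∣-given (S ∷ A ∷ ⁅ e ⁆ ∷ []) ∅ₑ ∅-empty (v₀ ─ₑ v₁) ∅ₑ (v₀ ─ₑ v₂ ─ₑ v₁) v₂ ⟩
      ∣ S - e ─ A ∣ + ∣ ⁅ e ⁆ ∣   ≡⟨ cong (∣ S - e ─ A ∣ +_) (∣⁅x⁆∣≡1 e) ⟩
      ∣ S - e ─ A ∣ + 1           ≡⟨ +-comm _ 1 ⟩
      suc ∣ S - e ─ A ∣           ∎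
      where open ≤-Reasoning
    go : ∀ S → Acc _<_ ∣ S ∣ → ∃ λ A → A ⊆ S × NoColoops M A × ρ A + ∣ S ─ A ∣ ≤ ρ S
    go S (acc rec) with any? (λ e → e ∈? S ×-dec ¬? (ρ (S - e) ≟ ρ S))
    ... | yes (e , e∈S , coloop) with go (S - e) (rec (x∈p⇒∣p-x∣<∣p∣ e∈S))
    ...   | A , A⊆S-e , noColoops , bound = A , ⊆-trans A⊆S-e (p─q⊆p S ⁅ e ⁆) , noColoops , (begin
      ρ A + ∣ S ─ A ∣             ≤⟨ +-monoʳ-≤ (ρ A) (∣─∣≤suc∣-─∣ S A e) ⟩
      ρ A + suc ∣ S - e ─ A ∣     ≡⟨ +-suc (ρ A) _ ⟩
      suc (ρ A + ∣ S - e ─ A ∣)   ≤⟨ s≤s bound ⟩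
      suc (ρ (S - e))             ≤⟨ ≤∧≢⇒< (rank-─⁅⁆≤ S e) coloop ⟩
      ρ S                         ∎)
      where open ≤-Reasoning
    go S _ | no no-coloop = S , ⊆-refl , noColoops , ≤-reflexive (trans (cong (λ k → ρ S + k) ∣S─S∣≡0) (+-identityʳ (ρ S)))
      where
      noColoops : NoColoops M S
      noColoops e e∈S with ρ (S - e) ≟ ρ S
      ... | yes eq = eq
      ... | no coloop = ⊥-elim (no-coloop (e , e∈S , coloop))
      ∣S─S∣≡0 : ∣ S ─ S ∣ ≡ 0
      ∣S─S∣≡0 = trans (cong ∣_∣ (solve-≡ (S ∷ []) (v₀ ─ₑ v₀) ∅ₑ)) (∣⊥∣≡0 n)

  -- r(S) is the minimum of r(G) + |S - G| over cyclic flats G; a rank witness attains it.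
  RankWitness : Subset n → Subset n → Set
  RankWitness G S = ρ G + ∣ S ─ G ∣ ≤ ρ S

  cyclicFlat-rankWitness : ∀ S → ∃ λ G → CyclicFlat M G × RankWitness G S
  cyclicFlat-rankWitness S with coloopFree-part S
  ... | A , _ , noColoops , bound = closure A , (closure-flat A , closure-noColoops A noColoops) ,
    ≤-trans (+-mono-≤ (≤-reflexive (rank-closure A)) (p⊆q⇒∣p∣≤∣q∣ S─clA⊆S─A)) bound
    where
    S─clA⊆S─A : S ─ closure A ⊆ S ─ A
    S─clA⊆S─A = solve-⊆-given (S ∷ A ∷ closure A ∷ []) (v₁ ─ₑ v₂) (⊆⇒─-empty (⊆closure A)) (v₀ ─ₑ v₂) (v₀ ─ₑ v₁)

  rankWitness-⊆ : ∀ {G S} → RankWitness G S → ∀ S′ → S′ ─ G ⊆ S ─ G → ρ S′ ≤ ρ S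
  rankWitness-⊆ {G} {S} witness S′ S′─G⊆S─G = begin
    ρ S′                ≤⟨ rank-≤-rank+∣─∣ S′ G ⟩
    ρ G + ∣ S′ ─ G ∣    ≤⟨ +-monoʳ-≤ (ρ G) (p⊆q⇒∣p∣≤∣q∣ S′─G⊆S─G) ⟩
    ρ G + ∣ S ─ G ∣     ≤⟨ witness ⟩
    ρ S                 ∎
    where open ≤-Reasoning

  rankWitness-⊂ : ∀ {G S} → RankWitness G S → ∀ S′ → S′ ─ G ⊆ S ─ G → ∀ {e} → e ∈ S → e ∉ G → e ∉ S′ → ρ S′ < ρ S
  rankWitness-⊂ {G} {S} witness S′ S′─G⊆S─G {e} e∈S e∉G e∉S′ = begin-strict
    ρ S′                ≤⟨ rank-≤-rank+∣─∣ S′ G ⟩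
    ρ G + ∣ S′ ─ G ∣    <⟨ +-monoʳ-< (ρ G) (p⊂q⇒∣p∣<∣q∣ (S′─G⊆S─G , e , x∈p∧x∉q⇒x∈p─q e∈S e∉G , e∉S′─G)) ⟩
    ρ G + ∣ S ─ G ∣     ≤⟨ witness ⟩
    ρ S                 ∎
    where
    open ≤-Reasoning
    e∉S′─G : e ∉ S′ ─ G
    e∉S′─G e∈ = e∉S′ (p─q⊆p S′ G e∈)

  nonModular⇒<  : ∀ {X Y} → ¬ Modular M X Y → ρ (X ∪ Y) + ρ (X ∩ Y) < ρ X + ρ Y
  nonModular⇒< {X} {Y} nonModular = ≤∧≢⇒< (r-submod M X Y) (λ eq → nonModular (sym eq))

  rankWitness-nonModular : ∀ {G₁ G₂ S₁ S₂} → RankWitness G₁ S₁ → RankWitness G₂ S₂ → ¬ Modular M G₁ G₂ →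
    ρ (S₁ ∪ S₂) + ρ (S₁ ∩ S₂) < ρ S₁ + ρ S₂
  rankWitness-nonModular {G₁} {G₂} {S₁} {S₂} witness₁ witness₂ nonModular = begin-strict
    ρ (S₁ ∪ S₂) + ρ (S₁ ∩ S₂)
      ≤⟨ +-mono-≤ (rank-≤-rank+∣─∣ (S₁ ∪ S₂) (G₁ ∪ G₂)) (rank-≤-rank+∣─∣ (S₁ ∩ S₂) (G₁ ∩ G₂)) ⟩
    (ρ (G₁ ∪ G₂) + ∣ S₁ ∪ S₂ ─ G₁ ∪ G₂ ∣) + (ρ (G₁ ∩ G₂) + ∣ S₁ ∩ S₂ ─ G₁ ∩ G₂ ∣)
      ≡⟨ interchange (ρ (G₁ ∪ G₂)) _ (ρ (G₁ ∩ G₂)) _ ⟩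
    (ρ (G₁ ∪ G₂) + ρ (G₁ ∩ G₂)) + (∣ S₁ ∪ S₂ ─ G₁ ∪ G₂ ∣ + ∣ S₁ ∩ S₂ ─ G₁ ∩ G₂ ∣)
      <⟨ +-mono-<-≤ (nonModular⇒< nonModular)
           (solve-∣∣-given (S₁ ∷ S₂ ∷ G₁ ∷ G₂ ∷ []) ∅ₑ ∅-empty
             ((v₀ ∪ₑ v₁) ─ₑ (v₂ ∪ₑ v₃)) ((v₀ ∩ₑ v₁) ─ₑ (v₂ ∩ₑ v₃)) (v₀ ─ₑ v₂) (v₁ ─ₑ v₃)) ⟩
    (ρ G₁ + ρ G₂) + (∣ S₁ ─ G₁ ∣ + ∣ S₂ ─ G₂ ∣)
      ≡⟨ interchange (ρ G₁) (ρ G₂) _ _ ⟩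
    (ρ G₁ + ∣ S₁ ─ G₁ ∣) + (ρ G₂ + ∣ S₂ ─ G₂ ∣)
      ≤⟨ +-mono-≤ witness₁ witness₂ ⟩
    ρ S₁ + ρ S₂ ∎
    where
    open ≤-Reasoning
    interchange : ∀ a b c d → (a + b) + (c + d) ≡ (a + c) + (b + d)
    interchange = solve-∀

  rank-∪⁅⁆-independent : ∀ {B P} e → B ⊆ P → ρ P < ρ (P ∪ ⁅ e ⁆) → ρ (B ∪ ⁅ e ⁆) ≡ suc (ρ B)
  rank-∪⁅⁆-independent {B} {P} e B⊆P P<P∪e = ≤-antisym (rank-∪⁅⁆≤suc B e)
    (+-cancelˡ-≤ (ρ P) _ _ (begin
      ρ P + suc (ρ B)          ≡⟨ +-suc (ρ P) (ρ B) ⟩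
      suc (ρ P) + ρ B          ≤⟨ +-monoˡ-≤ (ρ B) P<P∪e ⟩
      ρ (P ∪ ⁅ e ⁆) + ρ B      ≤⟨ rank-diminishing e B⊆P ⟩
      ρ P + ρ (B ∪ ⁅ e ⁆)      ∎))
    where open ≤-Reasoning

  module _ {P p q} (cyclicFlat : CyclicFlat M P) (p∈P : p ∈ P) (q∉P : q ∉ P) where

    rank-swapElt : ρ (swapElt q p P) ≡ suc (ρ P)
    rank-swapElt = trans (rank-∪⁅⁆-independent q (p─q⊆p P ⁅ p ⁆) (proj₁ cyclicFlat q q∉P))
                         (cong suc (proj₂ cyclicFlat p p∈P))

    rank-swapElt-∪⁅⁆ : ∀ {e} → e ∉ P → ρ P < ρ (P ∪ ⁅ e ⁆) ⊓ ρ (swapElt q p P ∪ ⁅ e ⁆)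
    rank-swapElt-∪⁅⁆ {e} e∉P =
      ⊓-glb (proj₁ cyclicFlat e e∉P) (≤-trans (≤-reflexive (sym rank-swapElt)) (rank-≤-∪⁅⁆ _ e))

    rank-swapElt-─⁅⁆ : ∀ {e} → e ∈ P → e ≢ p → ρ (P - e) ⊓ ρ (swapElt q p P - e) ≡ ρ P
    rank-swapElt-─⁅⁆ {e} e∈P e≢p =
      ≤-antisym (≤-trans (m⊓n≤m _ _) (rank-─⁅⁆≤ P e)) (⊓-glb (≤-reflexive (sym (proj₂ cyclicFlat e e∈P))) (begin
        ρ P                              ≡⟨ proj₂ cyclicFlat p p∈P ⟨
        ρ (P - p)                        ≤⟨ rank-≤suc-─⁅⁆ (P - p) e ⟩
        suc (ρ (P - p - e))              ≡⟨ rank-∪⁅⁆-independent q P-p-e⊆P (proj₁ cyclicFlat q q∉P) ⟨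
        ρ ((P - p - e) ∪ ⁅ q ⁆)          ≡⟨ cong ρ (solve-≡-given (P ∷ ⁅ p ⁆ ∷ ⁅ q ⁆ ∷ ⁅ e ⁆ ∷ []) (v₂ ∩ₑ v₃) (⁅⁆∩⁅⁆-empty q≢e)
                                             ((v₀ ─ₑ v₁ ─ₑ v₃) ∪ₑ v₂) ((v₀ ─ₑ v₁) ∪ₑ v₂ ─ₑ v₃)) ⟩
        ρ (swapElt q p P - e)            ∎))
      where
      open ≤-Reasoning
      q≢e : q ≢ e
      q≢e refl = q∉P e∈P
      P-p-e⊆P : P - p - e ⊆ P
      P-p-e⊆P = solve-⊆ (P ∷ ⁅ p ⁆ ∷ ⁅ e ⁆ ∷ []) (v₀ ─ₑ v₁ ─ₑ v₂) v₀

  p-x⊆q⇒x∈q : ∀ {A B a} → CyclicFlat M A → CyclicFlat M B → a ∈ A → A - a ⊆ B → a ∈ B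
  p-x⊆q⇒x∈q {A} {B} {a} (_ , noColoopsA) (flatB , _) a∈A A-a⊆B with a ∈? B
  ... | yes a∈B = a∈B
  ... | no a∉B = ⊥-elim (<⇒≱ (flatB a a∉B) (+-cancelʳ-≤ (ρ A) _ _ (begin
    ρ (B ∪ ⁅ a ⁆) + ρ A        ≡⟨ cong (ρ (B ∪ ⁅ a ⁆) +_) (noColoopsA a a∈A) ⟨
    ρ (B ∪ ⁅ a ⁆) + ρ (A - a)  ≤⟨ rank-submodular⊆ (solve-⊆-given (A ∷ B ∷ ⁅ a ⁆ ∷ []) (v₂ ─ₑ v₀) (⁅⁆─-empty a∈A) (v₁ ∪ₑ v₂) (v₀ ∪ₑ v₁))
                                                    (λ i∈ → x∈p∩q⁺ (p─q⊆p A ⁅ a ⁆ i∈ , A-a⊆B i∈)) ⟩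
    ρ A + ρ B                  ≡⟨ +-comm (ρ A) (ρ B) ⟩
    ρ B + ρ A                  ∎)))
    where open ≤-Reasoning

  rankWitness-separates : ∀ {x y X a G} → x ∈ X → a ≢ x → RankWitness G (X ∪ ⁅ a ⁆) →
    ρ (X ∪ ⁅ a ⁆) < ρ (swapElt y x X ∪ ⁅ a ⁆) → x ∈ G × y ∉ G
  rankWitness-separates {x} {y} {X} {a} {G} x∈X a≢x witness Xa<Qa = x∈G , y∉G
    where
    Γ : Vec (Subset n) 5
    Γ = X ∷ ⁅ a ⁆ ∷ ⁅ x ⁆ ∷ ⁅ y ⁆ ∷ G ∷ []
    𝑿 𝒂 𝒙 𝒚 𝑮 𝑸 : SetExpr 5
    𝑿 = v₀
    𝒂 = v₁
    𝒙 = v₂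
    𝒚 = v₃
    𝑮 = v₄
    𝑸 = (𝑿 ─ₑ 𝒙) ∪ₑ 𝒚
    y∉G : y ∉ G
    y∉G y∈G = <⇒≱ Xa<Qa (rankWitness-⊆ witness (swapElt y x X ∪ ⁅ a ⁆)
      (solve-⊆-given Γ (𝒚 ─ₑ 𝑮) (⁅⁆─-empty y∈G) ((𝑸 ∪ₑ 𝒂) ─ₑ 𝑮) ((𝑿 ∪ₑ 𝒂) ─ₑ 𝑮)))
    x∈G : x ∈ G
    x∈G with x ∈? G
    ... | yes x∈G = x∈G
    ... | no x∉G = ⊥-elim (<⇒≱ Xa<Qa (begin
      ρ (((X - x) ∪ ⁅ y ⁆) ∪ ⁅ a ⁆)  ≡⟨ cong ρ (∪⁅⁆-swap (X - x) y a) ⟩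
      ρ (((X - x) ∪ ⁅ a ⁆) ∪ ⁅ y ⁆)  ≤⟨ rank-∪⁅⁆≤suc _ y ⟩
      suc (ρ ((X - x) ∪ ⁅ a ⁆))      ≤⟨ rankWitness-⊂ witness ((X - x) ∪ ⁅ a ⁆)
                                          (solve-⊆ Γ (((𝑿 ─ₑ 𝒙) ∪ₑ 𝒂) ─ₑ 𝑮) ((𝑿 ∪ₑ 𝒂) ─ₑ 𝑮))
                                          (x∈p⇒x∈p∪⁅y⁆ x∈X) x∉G (x∉p⇒x∉p∪⁅y⁆ (x∉p-x X x) a≢x) ⟩
      ρ (X ∪ ⁅ a ⁆)                  ∎))
      where open ≤-Reasoning

  module _ {x y} (nonModular : NonModularSeparations M x y) where

    noCrossing : ∀ {X a b} → x ∈ X → y ∉ X → a ≢ x → b ≢ y →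
      ρ (X ∪ ⁅ a ⁆) < ρ (swapElt y x X ∪ ⁅ a ⁆) → ρ (swapElt y x X ∪ ⁅ b ⁆) < ρ (X ∪ ⁅ b ⁆) → ⊥
    noCrossing {X} {a} {b} x∈X y∉X a≢x b≢y Xa<Qa Qb<Xb
      with cyclicFlat-rankWitness (X ∪ ⁅ a ⁆) | cyclicFlat-rankWitness (swapElt y x X ∪ ⁅ b ⁆)
    ... | G₁ , cyclicFlat₁ , witness₁ | G₂ , cyclicFlat₂ , witness₂ =
      <⇒≱ (rankWitness-nonModular witness₁ witness₂ (nonModular G₁ G₂ (cyclicFlat₁ , separates₁) (cyclicFlat₂ , separates₂)))
        (+-cancelˡ-≤ 1 _ _ (begin
          suc (ρ S₁ + ρ S₂)                 ≤⟨ +-monoˡ-≤ (ρ S₂) (≤-trans Xa<Qa (rank-mono (solve-⊆ Γ (𝑸 ∪ₑ 𝒂) (𝑺₁ ∪ₑ 𝑺₂)))) ⟩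
          ρ (S₁ ∪ S₂) + ρ S₂                ≤⟨ +-monoʳ-≤ (ρ (S₁ ∪ S₂)) S₂≤suc[S₁∩S₂] ⟩
          ρ (S₁ ∪ S₂) + suc (ρ (S₁ ∩ S₂))   ≡⟨ +-suc (ρ (S₁ ∪ S₂)) _ ⟩
          suc (ρ (S₁ ∪ S₂) + ρ (S₁ ∩ S₂))   ∎))
      where
      open ≤-Reasoning
      Q S₁ S₂ : Subset n
      Q = swapElt y x X
      S₁ = X ∪ ⁅ a ⁆
      S₂ = Q ∪ ⁅ b ⁆
      Γ : Vec (Subset n) 5
      Γ = X ∷ ⁅ a ⁆ ∷ ⁅ b ⁆ ∷ ⁅ x ⁆ ∷ ⁅ y ⁆ ∷ []
      𝑿 𝒂 𝒃 𝒙 𝒚 𝑸 𝑺₁ 𝑺₂ : SetExpr 5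
      𝑿 = v₀
      𝒂 = v₁
      𝒃 = v₂
      𝒙 = v₃
      𝒚 = v₄
      𝑸 = (𝑿 ─ₑ 𝒙) ∪ₑ 𝒚
      𝑺₁ = 𝑿 ∪ₑ 𝒂
      𝑺₂ = 𝑸 ∪ₑ 𝒃
      separates₁ : x ∈ G₁ × y ∉ G₁
      separates₁ = rankWitness-separates x∈X a≢x witness₁ Xa<Qa
      separates₂ : y ∈ G₂ × x ∉ G₂
      separates₂ = rankWitness-separates (q∈swapElt-q-p X) b≢y witness₂
        (subst (λ P → ρ S₂ < ρ (P ∪ ⁅ b ⁆)) (sym (swapElt-involutive x∈X y∉X)) Qb<Xb)
      S₂≤suc[S₁∩S₂] : ρ S₂ ≤ suc (ρ (S₁ ∩ S₂))
      S₂≤suc[S₁∩S₂] = ≤-pred (begin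
        suc (ρ S₂)                    ≤⟨ Qb<Xb ⟩
        ρ (X ∪ ⁅ b ⁆)                 ≤⟨ rank-mono (solve-⊆ Γ (𝑿 ∪ₑ 𝒃) (((𝑿 ─ₑ 𝒙) ∪ₑ 𝒃) ∪ₑ 𝒙)) ⟩
        ρ (((X - x) ∪ ⁅ b ⁆) ∪ ⁅ x ⁆) ≤⟨ rank-∪⁅⁆≤suc _ x ⟩
        suc (ρ ((X - x) ∪ ⁅ b ⁆))     ≤⟨ s≤s (rank-∪⁅⁆≤suc (X - x) b) ⟩
        suc (suc (ρ (X - x)))         ≤⟨ s≤s (s≤s (rank-mono (solve-⊆ Γ (𝑿 ─ₑ 𝒙) (𝑺₁ ∩ₑ 𝑺₂)))) ⟩
        suc (suc (ρ (S₁ ∩ S₂)))       ∎)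

  cyclicFlat? : ∀ A → Dec (CyclicFlat M A)
  cyclicFlat? A = all? (λ e → ¬? (e ∈? A) →-dec (ρ A <? ρ (A ∪ ⁅ e ⁆)))
           ×-dec all? (λ e → (e ∈? A) →-dec (ρ (A - e) ≟ ρ A))

  InZdiff? : ∀ e f A → Dec (InZdiff M e f A)
  InZdiff? e f A = cyclicFlat? A ×-dec e ∈? A ×-dec ¬? (f ∈? A)

  ¬cyclicFlat-swapElt : ∀ {Y p q} → InZdiff M p q Y → ¬ CyclicFlat M (swapElt q p Y)
  ¬cyclicFlat-swapElt {Y} {p} {q} (cyclicFlatY , p∈Y , q∉Y) cyclicFlatS = <-irrefl refl (begin-strict
    ρ Y                       <⟨ ≤-reflexive (sym (rank-swapElt cyclicFlatY p∈Y q∉Y)) ⟩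
    ρ (swapElt q p Y)         <⟨ ≤-reflexive (sym (rank-swapElt cyclicFlatS (q∈swapElt-q-p Y) p∉S)) ⟩
    ρ (swapElt p q (swapElt q p Y)) ≡⟨ cong ρ (swapElt-involutive p∈Y q∉Y) ⟩
    ρ Y                       ∎)
    where
    open ≤-Reasoning
    p∉S : p ∉ swapElt q p Y
    p∉S = p∉swapElt-q-p Y (λ p≡q → q∉Y (subst (_∈ Y) p≡q p∈Y))

-- The matroid M′

module Construction {n : ℕ} (M : Matroid n) (x y : Fin n) (x≢y : x ≢ y) where

  open MatroidProperties M

  private
    ρ : Subset n → ℕ
    ρ = r M

  r′ : Subset n → ℕ
  r′ S with x ∈? S | y ∈? S
  ... | yes _ | no _ = ρ S ⊓ ρ (swapElt y x S)
  ... | no _ | yes _ = ρ S ⊔ ρ (swapElt x y S)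
  ... | _ | _ = ρ S

  data Position (S : Subset n) : Set where
    neither : x ∉ S → y ∉ S → Position S
    onlyX : x ∈ S → y ∉ S → Position S
    onlyY : x ∉ S → y ∈ S → Position S
    both : x ∈ S → y ∈ S → Position S

  position : ∀ S → Position S
  position S with x ∈? S | y ∈? S
  ... | no x∉S | no y∉S = neither x∉S y∉S
  ... | yes x∈S | no y∉S = onlyX x∈S y∉S
  ... | no x∉S | yes y∈S = onlyY x∉S y∈S
  ... | yes x∈S | yes y∈S = both x∈S y∈S

  data Role (e : Fin n) : Set where
    is-x : e ≡ x → Role e
    is-y : e ≡ y → Role e
    other : e ≢ x → e ≢ y → Role e

  role : ∀ e → Role e
  role e with e ≟ᶠ x | e ≟ᶠ y
  ... | yes e≡x | _ = is-x e≡x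
  ... | no _ | yes e≡y = is-y e≡y
  ... | no e≢x | no e≢y = other e≢x e≢y

  r′-neither : ∀ {S} → x ∉ S → y ∉ S → r′ S ≡ ρ S
  r′-neither {S} x∉S y∉S with x ∈? S | y ∈? S
  ... | yes x∈S | _ = ⊥-elim (x∉S x∈S)
  ... | no _ | yes y∈S = ⊥-elim (y∉S y∈S)
  ... | no _ | no _ = refl

  r′-both : ∀ {S} → x ∈ S → y ∈ S → r′ S ≡ ρ S
  r′-both {S} x∈S y∈S with x ∈? S | y ∈? S
  ... | no x∉S | _ = ⊥-elim (x∉S x∈S)
  ... | yes _ | no y∉S = ⊥-elim (y∉S y∈S)
  ... | yes _ | yes _ = refl

  r′-onlyX : ∀ {S} → x ∈ S → y ∉ S → r′ S ≡ ρ S ⊓ ρ (swapElt y x S)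
  r′-onlyX {S} x∈S y∉S with x ∈? S | y ∈? S
  ... | no x∉S | _ = ⊥-elim (x∉S x∈S)
  ... | yes _ | yes y∈S = ⊥-elim (y∉S y∈S)
  ... | yes _ | no _ = refl

  r′-onlyY : ∀ {S} → x ∉ S → y ∈ S → r′ S ≡ ρ S ⊔ ρ (swapElt x y S)
  r′-onlyY {S} x∉S y∈S with x ∈? S | y ∈? S
  ... | yes x∈S | _ = ⊥-elim (x∉S x∈S)
  ... | no _ | no y∉S = ⊥-elim (y∉S y∈S)
  ... | no _ | yes _ = refl

  r′-onlyY-⊓ : ∀ {S} → x ∉ S → y ∈ S → r′ S ≡ suc (ρ (S - y)) ⊓ ρ (S ∪ ⁅ x ⁆)
  r′-onlyY-⊓ {S} x∉S y∈S = begin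
    r′ S                                               ≡⟨ r′-onlyY x∉S y∈S ⟩
    ρ S ⊔ ρ ((S - y) ∪ ⁅ x ⁆)                          ≡⟨ cong (λ T → ρ T ⊔ ρ ((S - y) ∪ ⁅ x ⁆)) (p-x∪⁅x⁆≡p y∈S) ⟨
    ρ ((S - y) ∪ ⁅ y ⁆) ⊔ ρ ((S - y) ∪ ⁅ x ⁆)          ≡⟨ rank-∪⁅⁆-⊔ (S - y) y x ⟩
    suc (ρ (S - y)) ⊓ ρ (((S - y) ∪ ⁅ y ⁆) ∪ ⁅ x ⁆)    ≡⟨ cong (λ T → suc (ρ (S - y)) ⊓ ρ (T ∪ ⁅ x ⁆)) (p-x∪⁅x⁆≡p y∈S) ⟩
    suc (ρ (S - y)) ⊓ ρ (S ∪ ⁅ x ⁆)                    ∎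
    where open ≡-Reasoning

  r′-onlyX-∪⁅⁆ : ∀ {S e} → x ∈ S → y ∉ S → e ≢ x → e ≢ y →
    r′ (S ∪ ⁅ e ⁆) ≡ ρ (S ∪ ⁅ e ⁆) ⊓ ρ (swapElt y x S ∪ ⁅ e ⁆)
  r′-onlyX-∪⁅⁆ {S} {e} x∈S y∉S e≢x e≢y =
    trans (r′-onlyX (x∈p⇒x∈p∪⁅y⁆ x∈S) (x∉p⇒x∉p∪⁅y⁆ y∉S e≢y)) (cong (λ T → ρ (S ∪ ⁅ e ⁆) ⊓ ρ T) (swapElt-∪⁅⁆ S e≢x))

  r′-onlyX-─⁅⁆ : ∀ {S e} → x ∈ S → y ∉ S → e ≢ x → e ≢ y →
    r′ (S - e) ≡ ρ (S - e) ⊓ ρ (swapElt y x S - e)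
  r′-onlyX-─⁅⁆ {S} {e} x∈S y∉S e≢x e≢y =
    trans (r′-onlyX (x∈p⇒x∈p-y x∈S e≢x) (x∉p⇒x∉p-y y∉S)) (cong (λ T → ρ (S - e) ⊓ ρ T) (swapElt-─⁅⁆ S e≢y))

  r′-∪⁅x⁆ : ∀ {T} → x ∉ T → y ∉ T → r′ (T ∪ ⁅ x ⁆) ≡ ρ (T ∪ ⁅ x ⁆) ⊓ ρ (T ∪ ⁅ y ⁆)
  r′-∪⁅x⁆ {T} x∉T y∉T = trans (r′-onlyX (x∈p∪⁅x⁆ T x) (x∉p⇒x∉p∪⁅y⁆ y∉T x≢y))
    (cong (λ S → ρ (T ∪ ⁅ x ⁆) ⊓ ρ S) (swapElt-∪⁅⁆-same y x∉T))

  r′-∪⁅y⁆ : ∀ {T} → x ∉ T → y ∉ T → r′ (T ∪ ⁅ y ⁆) ≡ ρ (T ∪ ⁅ y ⁆) ⊔ ρ (T ∪ ⁅ x ⁆)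
  r′-∪⁅y⁆ {T} x∉T y∉T = trans (r′-onlyY (x∉p⇒x∉p∪⁅y⁆ x∉T (≢-sym x≢y)) (x∈p∪⁅x⁆ T y))
    (cong (λ S → ρ (T ∪ ⁅ y ⁆) ⊔ ρ S) (swapElt-∪⁅⁆-same x y∉T))

  r′-∪⁅y⁆-⊓ : ∀ {T} → x ∉ T → y ∉ T → r′ (T ∪ ⁅ y ⁆) ≡ suc (ρ T) ⊓ ρ ((T ∪ ⁅ y ⁆) ∪ ⁅ x ⁆)
  r′-∪⁅y⁆-⊓ {T} x∉T y∉T = trans (r′-onlyY-⊓ (x∉p⇒x∉p∪⁅y⁆ x∉T (≢-sym x≢y)) (x∈p∪⁅x⁆ T y))
    (cong (λ S → suc (ρ S) ⊓ ρ ((T ∪ ⁅ y ⁆) ∪ ⁅ x ⁆)) (p∪⁅x⁆-x≡p y∉T))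

  r′-locallySubmodularAt-x-y : ∀ {T} → x ∉ T → y ∉ T → LocallySubmodularAt r′ T x y
  r′-locallySubmodularAt-x-y {T} x∉T y∉T = +≤+-via-≡
    (r′-both (x∈p⇒x∈p∪⁅y⁆ (x∈p∪⁅x⁆ T x)) (x∈p∪⁅x⁆ _ y)) (r′-neither x∉T y∉T) (r′-∪⁅x⁆ x∉T y∉T) (r′-∪⁅y⁆ x∉T y∉T)
    (begin
      ρ ((T ∪ ⁅ x ⁆) ∪ ⁅ y ⁆) + ρ T   ≤⟨ rank-locallySubmodularAt T x y ⟩
      ρ (T ∪ ⁅ x ⁆) + ρ (T ∪ ⁅ y ⁆)   ≡⟨ ⊓+⊔≡+ (ρ (T ∪ ⁅ x ⁆)) (ρ (T ∪ ⁅ y ⁆)) ⟨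
      (ρ (T ∪ ⁅ x ⁆) ⊓ ρ (T ∪ ⁅ y ⁆)) + (ρ (T ∪ ⁅ x ⁆) ⊔ ρ (T ∪ ⁅ y ⁆))
                                      ≡⟨ cong (ρ (T ∪ ⁅ x ⁆) ⊓ ρ (T ∪ ⁅ y ⁆) +_) (⊔-comm (ρ (T ∪ ⁅ x ⁆)) _) ⟩
      (ρ (T ∪ ⁅ x ⁆) ⊓ ρ (T ∪ ⁅ y ⁆)) + (ρ (T ∪ ⁅ y ⁆) ⊔ ρ (T ∪ ⁅ x ⁆)) ∎)
    where open ≤-Reasoning

  r′-locallySubmodularAt-x : ∀ {X a} → a ≢ x → a ≢ y → x ∉ X → LocallySubmodularAt r′ X a x
  r′-locallySubmodularAt-x {X} {a} a≢x a≢y x∉X with position X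
  ... | onlyX x∈X _ = ⊥-elim (x∉X x∈X)
  ... | both x∈X _ = ⊥-elim (x∉X x∈X)
  ... | neither _ y∉X =
    +≤+-via-≡ (r′-∪⁅x⁆ (x∉p⇒x∉p∪⁅y⁆ x∉X a≢x) (x∉p⇒x∉p∪⁅y⁆ y∉X a≢y)) (r′-neither x∉X y∉X)
            (r′-neither (x∉p⇒x∉p∪⁅y⁆ x∉X a≢x) (x∉p⇒x∉p∪⁅y⁆ y∉X a≢y)) (r′-∪⁅x⁆ x∉X y∉X)
      (⊓+≤+⊓ (ρ ((X ∪ ⁅ a ⁆) ∪ ⁅ x ⁆)) (ρ ((X ∪ ⁅ a ⁆) ∪ ⁅ y ⁆)) (ρ (X ∪ ⁅ x ⁆)) (ρ (X ∪ ⁅ y ⁆)) (ρ X) (ρ (X ∪ ⁅ a ⁆))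
        (rank-locallySubmodularAt X a x) (rank-locallySubmodularAt X a y))
  ... | onlyY _ y∈X =
    +≤+-via-≡ (r′-both (x∈p∪⁅x⁆ _ x) (x∈p⇒x∈p∪⁅y⁆ (x∈p⇒x∈p∪⁅y⁆ y∈X))) (r′-onlyY-⊓ x∉X y∈X)
            (r′-onlyY-⊓ (x∉p⇒x∉p∪⁅y⁆ x∉X a≢x) (x∈p⇒x∈p∪⁅y⁆ y∈X)) (r′-both (x∈p∪⁅x⁆ X x) (x∈p⇒x∈p∪⁅y⁆ y∈X))
      (+⊓≤⊓+ (u X) (v X) (u (X ∪ ⁅ a ⁆)) (v (X ∪ ⁅ a ⁆)) (v (X ∪ ⁅ a ⁆)) (v X)
        (+-suc-≤ (v (X ∪ ⁅ a ⁆)) (ρ (X - y)) (ρ ((X ∪ ⁅ a ⁆) - y)) (v X)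
           (rank-submodular-given (X ∷ ⁅ a ⁆ ∷ ⁅ x ⁆ ∷ ⁅ y ⁆ ∷ []) (v₃ ─ₑ v₀) (⁅⁆─-empty y∈X)
           ((v₀ ∪ₑ v₁) ∪ₑ v₂) (v₀ ─ₑ v₃) ((v₀ ∪ₑ v₁) ─ₑ v₃) (v₀ ∪ₑ v₂)))
        ≤-refl)
    where
    u v : Subset n → ℕ
    u S = suc (ρ (S - y))
    v S = ρ (S ∪ ⁅ x ⁆)

  r′-locallySubmodularAt-y : ∀ {X a} → a ≢ x → a ≢ y → y ∉ X → LocallySubmodularAt r′ X a y
  r′-locallySubmodularAt-y {X} {a} a≢x a≢y y∉X with position X
  ... | onlyY _ y∈X = ⊥-elim (y∉X y∈X)
  ... | both _ y∈X = ⊥-elim (y∉X y∈X)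
  ... | neither x∉X _ =
    +≤+-via-≡ (r′-∪⁅y⁆-⊓ (x∉p⇒x∉p∪⁅y⁆ x∉X a≢x) (x∉p⇒x∉p∪⁅y⁆ y∉X a≢y)) (r′-neither x∉X y∉X)
            (r′-neither (x∉p⇒x∉p∪⁅y⁆ x∉X a≢x) (x∉p⇒x∉p∪⁅y⁆ y∉X a≢y)) (r′-∪⁅y⁆-⊓ x∉X y∉X)
      (⊓+≤+⊓ (suc (ρ (X ∪ ⁅ a ⁆))) (ρ (((X ∪ ⁅ a ⁆) ∪ ⁅ y ⁆) ∪ ⁅ x ⁆)) (suc (ρ X)) (ρ ((X ∪ ⁅ y ⁆) ∪ ⁅ x ⁆))
             (ρ X) (ρ (X ∪ ⁅ a ⁆))
        (≤-reflexive (sym (+-suc (ρ (X ∪ ⁅ a ⁆)) (ρ X))))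
        (rank-submodular-given (X ∷ ⁅ a ⁆ ∷ ⁅ x ⁆ ∷ ⁅ y ⁆ ∷ []) ∅ₑ ∅-empty
          (((v₀ ∪ₑ v₁) ∪ₑ v₃) ∪ₑ v₂) v₀ (v₀ ∪ₑ v₁) ((v₀ ∪ₑ v₃) ∪ₑ v₂)))
  ... | onlyX x∈X _ =
    +≤+-via-≡ (r′-both (x∈p⇒x∈p∪⁅y⁆ (x∈p⇒x∈p∪⁅y⁆ x∈X)) (x∈p∪⁅x⁆ _ y)) (r′-onlyX x∈X y∉X)
            (r′-onlyX-∪⁅⁆ x∈X y∉X a≢x a≢y) (r′-both (x∈p⇒x∈p∪⁅y⁆ x∈X) (x∈p∪⁅x⁆ X y))
      (+⊓≤⊓+ (ρ X) (ρ Q) (ρ (X ∪ ⁅ a ⁆)) (ρ (Q ∪ ⁅ a ⁆)) (ρ ((X ∪ ⁅ a ⁆) ∪ ⁅ y ⁆)) (ρ (X ∪ ⁅ y ⁆))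
        (rank-locallySubmodularAt X a y)
        (rank-submodular-given (X ∷ ⁅ a ⁆ ∷ ⁅ x ⁆ ∷ ⁅ y ⁆ ∷ []) ∅ₑ ∅-empty
          ((v₀ ∪ₑ v₁) ∪ₑ v₃) ((v₀ ─ₑ v₂) ∪ₑ v₃) (((v₀ ─ₑ v₂) ∪ₑ v₃) ∪ₑ v₁) (v₀ ∪ₑ v₃)))
    where
    Q : Subset n
    Q = swapElt y x X

  r′-≤-∪⁅⁆ : ∀ X e → r′ X ≤ r′ (X ∪ ⁅ e ⁆)
  r′-≤-∪⁅⁆ X e with e ∈? X
  ... | yes e∈X = ≤-reflexive (cong r′ (sym (x∈p⇒p∪⁅x⁆≡p e∈X)))
  ... | no e∉X with role e | position X
  ...   | other e≢x e≢y | neither x∉X y∉X =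
    ≤-via-≡ (r′-neither x∉X y∉X) (r′-neither (x∉p⇒x∉p∪⁅y⁆ x∉X e≢x) (x∉p⇒x∉p∪⁅y⁆ y∉X e≢y)) (rank-≤-∪⁅⁆ X e)
  ...   | other e≢x e≢y | both x∈X y∈X =
    ≤-via-≡ (r′-both x∈X y∈X) (r′-both (x∈p⇒x∈p∪⁅y⁆ x∈X) (x∈p⇒x∈p∪⁅y⁆ y∈X)) (rank-≤-∪⁅⁆ X e)
  ...   | other e≢x e≢y | onlyX x∈X y∉X =
    ≤-via-≡ (r′-onlyX x∈X y∉X) (r′-onlyX-∪⁅⁆ x∈X y∉X e≢x e≢y)
      (⊓-mono-≤ (rank-≤-∪⁅⁆ X e) (rank-≤-∪⁅⁆ (swapElt y x X) e))
  ...   | other e≢x e≢y | onlyY x∉X y∈X =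
    ≤-via-≡ (r′-onlyY-⊓ x∉X y∈X) (r′-onlyY-⊓ (x∉p⇒x∉p∪⁅y⁆ x∉X e≢x) (x∈p⇒x∈p∪⁅y⁆ y∈X))
      (⊓-mono-≤ (s≤s (rank-mono (p⊆q⇒p-x⊆q-x y (p⊆p∪q ⁅ e ⁆))))
                (rank-mono (solve-⊆ (X ∷ ⁅ e ⁆ ∷ ⁅ x ⁆ ∷ []) (v₀ ∪ₑ v₂) ((v₀ ∪ₑ v₁) ∪ₑ v₂))))
  ...   | is-x refl | neither x∉X y∉X =
    ≤-via-≡ (r′-neither x∉X y∉X) (r′-∪⁅x⁆ x∉X y∉X) (⊓-glb (rank-≤-∪⁅⁆ X x) (rank-≤-∪⁅⁆ X y))
  ...   | is-x refl | onlyY x∉X y∈X =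
    ≤-via-≡ (r′-onlyY-⊓ x∉X y∈X) (r′-both (x∈p∪⁅x⁆ X x) (x∈p⇒x∈p∪⁅y⁆ y∈X)) (m⊓n≤n _ _)
  ...   | is-y refl | neither x∉X y∉X =
    ≤-via-≡ (r′-neither x∉X y∉X) (r′-∪⁅y⁆ x∉X y∉X) (≤-trans (rank-≤-∪⁅⁆ X y) (m≤m⊔n _ _))
  ...   | is-y refl | onlyX x∈X y∉X =
    ≤-via-≡ (r′-onlyX x∈X y∉X) (r′-both (x∈p⇒x∈p∪⁅y⁆ x∈X) (x∈p∪⁅x⁆ X y)) (≤-trans (m⊓n≤m _ _) (rank-≤-∪⁅⁆ X y))
  ...   | is-x refl | onlyX x∈X _ = ⊥-elim (e∉X x∈X)
  ...   | is-x refl | both x∈X _ = ⊥-elim (e∉X x∈X)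
  ...   | is-y refl | onlyY _ y∈X = ⊥-elim (e∉X y∈X)
  ...   | is-y refl | both _ y∈X = ⊥-elim (e∉X y∈X)

  r′-bound : ∀ S → r′ S ≤ ∣ S ∣
  r′-bound S with position S
  ... | neither x∉S y∉S = ≤-trans (≤-reflexive (r′-neither x∉S y∉S)) (r-bound M S)
  ... | both x∈S y∈S = ≤-trans (≤-reflexive (r′-both x∈S y∈S)) (r-bound M S)
  ... | onlyX x∈S y∉S = ≤-trans (≤-reflexive (r′-onlyX x∈S y∉S)) (≤-trans (m⊓n≤m _ _) (r-bound M S))
  ... | onlyY x∉S y∈S = ≤-trans (≤-reflexive (r′-onlyY-⊓ x∉S y∈S))
    (≤-trans (m⊓n≤m _ _) (≤-trans (s≤s (r-bound M (S - y))) (x∈p⇒∣p-x∣<∣p∣ y∈S)))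

  r′-locallySubmodularAt-onlyY : ∀ {X a b} → x ∉ X → y ∈ X → a ≢ x → b ≢ x → LocallySubmodularAt r′ X a b
  r′-locallySubmodularAt-onlyY {X} {a} {b} x∉X y∈X a≢x b≢x =
    +≤+-via-≡ (r′-onlyY-⊓ (x∉p⇒x∉p∪⁅y⁆ (x∉p⇒x∉p∪⁅y⁆ x∉X a≢x) b≢x) (x∈p⇒x∈p∪⁅y⁆ (x∈p⇒x∈p∪⁅y⁆ y∈X))) (r′-onlyY-⊓ x∉X y∈X)
            (r′-onlyY-⊓ (x∉p⇒x∉p∪⁅y⁆ x∉X a≢x) (x∈p⇒x∈p∪⁅y⁆ y∈X)) (r′-onlyY-⊓ (x∉p⇒x∉p∪⁅y⁆ x∉X b≢x) (x∈p⇒x∈p∪⁅y⁆ y∈X))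
      (⊓-submodular (u X) (u (X ∪ ⁅ a ⁆)) (u (X ∪ ⁅ b ⁆)) (u ((X ∪ ⁅ a ⁆) ∪ ⁅ b ⁆))
                    (v X) (v (X ∪ ⁅ a ⁆)) (v (X ∪ ⁅ b ⁆)) (v ((X ∪ ⁅ a ⁆) ∪ ⁅ b ⁆))
        (suc∘-locallySubmodularAt (λ S → ρ (S - y))
          (rank-submodular-given Γ ∅ₑ ∅-empty (((𝑿 ∪ₑ 𝒂) ∪ₑ 𝒃) ─ₑ 𝒚) (𝑿 ─ₑ 𝒚) ((𝑿 ∪ₑ 𝒂) ─ₑ 𝒚) ((𝑿 ∪ₑ 𝒃) ─ₑ 𝒚)))
        (rank-submodular-given Γ ∅ₑ ∅-empty (((𝑿 ∪ₑ 𝒂) ∪ₑ 𝒃) ∪ₑ 𝒙) (𝑿 ∪ₑ 𝒙) ((𝑿 ∪ₑ 𝒂) ∪ₑ 𝒙) ((𝑿 ∪ₑ 𝒃) ∪ₑ 𝒙))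
        (mixed a b)
        (subst₂ (λ S k → (u S ⊓ v S) + (u X ⊓ v X) ≤ k) (∪⁅⁆-swap X b a) (+-comm (u (X ∪ ⁅ b ⁆)) (v (X ∪ ⁅ a ⁆)))
          (mixed b a)))
    where
    u v : Subset n → ℕ
    u S = suc (ρ (S - y))
    v S = ρ (S ∪ ⁅ x ⁆)
    Γ : Vec (Subset n) 5
    Γ = X ∷ ⁅ a ⁆ ∷ ⁅ b ⁆ ∷ ⁅ x ⁆ ∷ ⁅ y ⁆ ∷ []
    𝑿 𝒂 𝒃 𝒙 𝒚 : SetExpr 5
    𝑿 = v₀
    𝒂 = v₁
    𝒃 = v₂
    𝒙 = v₃
    𝒚 = v₄
    mixed : ∀ a b → (u ((X ∪ ⁅ a ⁆) ∪ ⁅ b ⁆) ⊓ v ((X ∪ ⁅ a ⁆) ∪ ⁅ b ⁆)) + (u X ⊓ v X) ≤ u (X ∪ ⁅ a ⁆) + v (X ∪ ⁅ b ⁆)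
    mixed a b = ≤-trans (+-mono-≤ (m⊓n≤n (u ((X ∪ ⁅ a ⁆) ∪ ⁅ b ⁆)) (v ((X ∪ ⁅ a ⁆) ∪ ⁅ b ⁆))) (m⊓n≤m (u X) (v X)))
      (+-suc-≤ (v ((X ∪ ⁅ a ⁆) ∪ ⁅ b ⁆)) (ρ (X - y)) (ρ ((X ∪ ⁅ a ⁆) - y)) (v (X ∪ ⁅ b ⁆))
        (rank-submodular-given (X ∷ ⁅ a ⁆ ∷ ⁅ b ⁆ ∷ ⁅ x ⁆ ∷ ⁅ y ⁆ ∷ []) (v₄ ─ₑ v₀) (⁅⁆─-empty y∈X)
          (((v₀ ∪ₑ v₁) ∪ₑ v₂) ∪ₑ v₃) (v₀ ─ₑ v₄) ((v₀ ∪ₑ v₁) ─ₑ v₄) ((v₀ ∪ₑ v₂) ∪ₑ v₃)))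

  module _ (nonModular : NonModularSeparations M x y) where

    r′-locallySubmodularAt-onlyX : ∀ {X a b} → x ∈ X → y ∉ X → a ≢ x → a ≢ y → b ≢ x → b ≢ y →
      LocallySubmodularAt r′ X a b
    r′-locallySubmodularAt-onlyX {X} {a} {b} x∈X y∉X a≢x a≢y b≢x b≢y =
      +≤+-via-≡ (trans (r′-onlyX-∪⁅⁆ (x∈p⇒x∈p∪⁅y⁆ x∈X) (x∉p⇒x∉p∪⁅y⁆ y∉X a≢y) b≢x b≢y)
                     (cong (λ T → ρ ((X ∪ ⁅ a ⁆) ∪ ⁅ b ⁆) ⊓ ρ (T ∪ ⁅ b ⁆)) (swapElt-∪⁅⁆ X a≢x)))
              (r′-onlyX x∈X y∉X) (r′-onlyX-∪⁅⁆ x∈X y∉X a≢x a≢y) (r′-onlyX-∪⁅⁆ x∈X y∉X b≢x b≢y)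
        (⊓-submodular-uncrossed (ρ X) (ρ (X ∪ ⁅ a ⁆)) (ρ (X ∪ ⁅ b ⁆)) (ρ ((X ∪ ⁅ a ⁆) ∪ ⁅ b ⁆))
                                (ρ Q) (ρ (Q ∪ ⁅ a ⁆)) (ρ (Q ∪ ⁅ b ⁆)) (ρ ((Q ∪ ⁅ a ⁆) ∪ ⁅ b ⁆))
          (rank-locallySubmodularAt X a b) (rank-locallySubmodularAt Q a b)
          (λ (Xa<Qa , Qb<Xb) → noCrossing nonModular x∈X y∉X a≢x b≢y Xa<Qa Qb<Xb)
          (λ (Qa<Xa , Xb<Qb) → noCrossing nonModular x∈X y∉X b≢x a≢y Xb<Qb Qa<Xa))
      where
      Q : Subset n
      Q = swapElt y x X

    r′-locallySubmodularAt-others : ∀ {X a b} → a ≢ x → a ≢ y → b ≢ x → b ≢ y → LocallySubmodularAt r′ X a b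
    r′-locallySubmodularAt-others {X} {a} {b} a≢x a≢y b≢x b≢y with position X
    ... | neither x∉X y∉X =
      +≤+-via-≡ (r′-neither (x∉p⇒x∉p∪⁅y⁆ (x∉p⇒x∉p∪⁅y⁆ x∉X a≢x) b≢x) (x∉p⇒x∉p∪⁅y⁆ (x∉p⇒x∉p∪⁅y⁆ y∉X a≢y) b≢y)) (r′-neither x∉X y∉X)
              (r′-neither (x∉p⇒x∉p∪⁅y⁆ x∉X a≢x) (x∉p⇒x∉p∪⁅y⁆ y∉X a≢y)) (r′-neither (x∉p⇒x∉p∪⁅y⁆ x∉X b≢x) (x∉p⇒x∉p∪⁅y⁆ y∉X b≢y))
        (rank-locallySubmodularAt X a b)
    ... | both x∈X y∈X =
      +≤+-via-≡ (r′-both (x∈p⇒x∈p∪⁅y⁆ (x∈p⇒x∈p∪⁅y⁆ x∈X)) (x∈p⇒x∈p∪⁅y⁆ (x∈p⇒x∈p∪⁅y⁆ y∈X))) (r′-both x∈X y∈X)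
              (r′-both (x∈p⇒x∈p∪⁅y⁆ x∈X) (x∈p⇒x∈p∪⁅y⁆ y∈X)) (r′-both (x∈p⇒x∈p∪⁅y⁆ x∈X) (x∈p⇒x∈p∪⁅y⁆ y∈X))
        (rank-locallySubmodularAt X a b)
    ... | onlyX x∈X y∉X = r′-locallySubmodularAt-onlyX x∈X y∉X a≢x a≢y b≢x b≢y
    ... | onlyY x∉X y∈X = r′-locallySubmodularAt-onlyY x∉X y∈X a≢x b≢x

    r′-locallySubmodular : LocallySubmodular r′
    r′-locallySubmodular X a b a∉X b∉X a≢b with role a | role b
    ... | other a≢x a≢y | other b≢x b≢y = r′-locallySubmodularAt-others a≢x a≢y b≢x b≢y
    ... | other a≢x a≢y | is-x refl = r′-locallySubmodularAt-x a≢x a≢y b∉X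
    ... | other a≢x a≢y | is-y refl = r′-locallySubmodularAt-y a≢x a≢y b∉X
    ... | is-x refl | other b≢x b≢y = locallySubmodularAt-sym r′ (r′-locallySubmodularAt-x b≢x b≢y a∉X)
    ... | is-y refl | other b≢x b≢y = locallySubmodularAt-sym r′ (r′-locallySubmodularAt-y b≢x b≢y a∉X)
    ... | is-x refl | is-y refl = r′-locallySubmodularAt-x-y a∉X b∉X
    ... | is-y refl | is-x refl = locallySubmodularAt-sym r′ (r′-locallySubmodularAt-x-y b∉X a∉X)
    ... | is-x refl | is-x refl = ⊥-elim (a≢b refl)
    ... | is-y refl | is-y refl = ⊥-elim (a≢b refl)

    M′ : Matroid n
    M′ = record
      { r        = r′
      ; r-bound  = r′-bound
      ; r-mono   = λ _ _ → locallyMonotone⇒monotone r′ r′-≤-∪⁅⁆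
      ; r-submod = locallySubmodular⇒submodular r′ r′-locallySubmodular
      }

-- Cyclic flats and configuration of M′

module CyclicFlats {n : ℕ} (M : Matroid n) (x y : Fin n) (x≢y : x ≢ y)
  (nonModular : NonModularSeparations M x y) where

  open MatroidProperties M
  open Construction M x y x≢y

  private
    ρ : Subset n → ℕ
    ρ = r M
    N : Matroid n
    N = M′ nonModular

  r′-onlyX-cyclicFlat : ∀ {A} → CyclicFlat M A → x ∈ A → y ∉ A → r′ A ≡ ρ A
  r′-onlyX-cyclicFlat cyclicFlat x∈A y∉A =
    trans (r′-onlyX x∈A y∉A) (m≤n⇒m⊓n≡m (<⇒≤ (≤-reflexive (sym (rank-swapElt cyclicFlat x∈A y∉A)))))

  r′-preserved : ∀ {A} → CyclicFlat M A → ¬ InZdiff M y x A → r′ A ≡ ρ A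
  r′-preserved {A} cyclicFlat notYX with position A
  ... | neither x∉A y∉A = r′-neither x∉A y∉A
  ... | both x∈A y∈A = r′-both x∈A y∈A
  ... | onlyX x∈A y∉A = r′-onlyX-cyclicFlat cyclicFlat x∈A y∉A
  ... | onlyY x∉A y∈A = ⊥-elim (notYX (cyclicFlat , y∈A , x∉A))

  module Exchanged {Y} (cyclicFlat : CyclicFlat M Y) (y∈Y : y ∈ Y) (x∉Y : x ∉ Y) where

    private
      S : Subset n
      S = swapElt x y Y
      x∈S : x ∈ S
      x∈S = q∈swapElt-q-p Y
      y∉S : y ∉ S
      y∉S = p∉swapElt-q-p Y (≢-sym x≢y)
      S⇄Y : swapElt y x S ≡ Y
      S⇄Y = swapElt-involutive y∈Y x∉Y

    r′-swapped : r′ S ≡ ρ Y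
    r′-swapped = trans (r′-onlyX x∈S y∉S) (trans (cong (λ T → ρ S ⊓ ρ T) S⇄Y)
      (m≥n⇒m⊓n≡n (<⇒≤ (≤-reflexive (sym (rank-swapElt cyclicFlat y∈Y x∉Y))))))

    cyclicFlat-swapped : CyclicFlat N S
    cyclicFlat-swapped = flat , noColoops
      where
      flat : Flat N S
      flat e e∉S with role e
      ... | is-x refl = ⊥-elim (e∉S x∈S)
      ... | is-y refl = <-via-≡ r′-swapped (r′-both (x∈p⇒x∈p∪⁅y⁆ x∈S) (x∈p∪⁅x⁆ S y))
        (≤-trans (proj₁ cyclicFlat x x∉Y)
          (rank-mono (solve-⊆ (Y ∷ ⁅ x ⁆ ∷ ⁅ y ⁆ ∷ []) (v₀ ∪ₑ v₁) (((v₀ ─ₑ v₂) ∪ₑ v₁) ∪ₑ v₂))))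
      ... | other e≢x e≢y = <-via-≡ r′-swapped
        (trans (r′-onlyX-∪⁅⁆ x∈S y∉S e≢x e≢y) (trans (cong (λ T → ρ (S ∪ ⁅ e ⁆) ⊓ ρ (T ∪ ⁅ e ⁆)) S⇄Y)
          (⊓-comm (ρ (S ∪ ⁅ e ⁆)) (ρ (Y ∪ ⁅ e ⁆)))))
        (rank-swapElt-∪⁅⁆ cyclicFlat y∈Y x∉Y (λ e∈Y → e∉S (x∈swapElt⁺ e∈Y e≢y)))
      noColoops : NoColoops N S
      noColoops e e∈S with role e
      ... | is-y refl = ⊥-elim (y∉S e∈S)
      ... | is-x refl = begin
        r′ (S - x)    ≡⟨ r′-neither (x∉p-x S x) (x∉p⇒x∉p-y y∉S) ⟩
        ρ (S - x)     ≡⟨ cong ρ (p∪⁅x⁆-x≡p (x∉p⇒x∉p-y x∉Y)) ⟩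
        ρ (Y - y)     ≡⟨ proj₂ cyclicFlat y y∈Y ⟩
        ρ Y           ≡⟨ r′-swapped ⟨
        r′ S          ∎
        where open ≡-Reasoning
      ... | other e≢x e≢y = begin
        r′ (S - e)                    ≡⟨ r′-onlyX-─⁅⁆ x∈S y∉S e≢x e≢y ⟩
        ρ (S - e) ⊓ ρ (swapElt y x S - e) ≡⟨ cong (λ T → ρ (S - e) ⊓ ρ (T - e)) S⇄Y ⟩
        ρ (S - e) ⊓ ρ (Y - e)         ≡⟨ ⊓-comm (ρ (S - e)) (ρ (Y - e)) ⟩
        ρ (Y - e) ⊓ ρ (S - e)         ≡⟨ rank-swapElt-─⁅⁆ cyclicFlat y∈Y x∉Y (x∈swapElt⁻ e∈S e≢x) e≢y ⟩
        ρ Y                           ≡⟨ r′-swapped ⟨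
        r′ S                          ∎
        where open ≡-Reasoning

  module _ {A} (cyclicFlat : CyclicFlat M A) (notYX : ¬ InZdiff M y x A) where

    private
      flatA : Flat M A
      flatA = proj₁ cyclicFlat
      noColoopsA : NoColoops M A
      noColoopsA = proj₂ cyclicFlat
      r′A≡ρA : r′ A ≡ ρ A
      r′A≡ρA = r′-preserved cyclicFlat notYX

    flat-preserved : Flat N A
    flat-preserved e e∉A with position A | role e
    ... | onlyY x∉A y∈A | _ = ⊥-elim (notYX (cyclicFlat , y∈A , x∉A))
    ... | neither x∉A y∉A | other e≢x e≢y =
      <-via-≡ r′A≡ρA (r′-neither (x∉p⇒x∉p∪⁅y⁆ x∉A e≢x) (x∉p⇒x∉p∪⁅y⁆ y∉A e≢y)) (flatA e e∉A)
    ... | neither x∉A y∉A | is-x refl =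
      <-via-≡ r′A≡ρA (r′-∪⁅x⁆ x∉A y∉A) (⊓-glb (flatA x x∉A) (flatA y y∉A))
    ... | neither x∉A y∉A | is-y refl =
      <-via-≡ r′A≡ρA (r′-∪⁅y⁆ x∉A y∉A) (≤-trans (flatA y y∉A) (m≤m⊔n _ _))
    ... | both x∈A y∈A | other e≢x e≢y =
      <-via-≡ r′A≡ρA (r′-both (x∈p⇒x∈p∪⁅y⁆ x∈A) (x∈p⇒x∈p∪⁅y⁆ y∈A)) (flatA e e∉A)
    ... | onlyX x∈A y∉A | other e≢x e≢y =
      <-via-≡ r′A≡ρA (r′-onlyX-∪⁅⁆ x∈A y∉A e≢x e≢y) (rank-swapElt-∪⁅⁆ cyclicFlat x∈A y∉A e∉A)
    ... | onlyX x∈A y∉A | is-y refl =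
      <-via-≡ r′A≡ρA (r′-both (x∈p⇒x∈p∪⁅y⁆ x∈A) (x∈p∪⁅x⁆ A y)) (flatA y y∉A)
    ... | both x∈A _ | is-x refl = ⊥-elim (e∉A x∈A)
    ... | both _ y∈A | is-y refl = ⊥-elim (e∉A y∈A)
    ... | onlyX x∈A _ | is-x refl = ⊥-elim (e∉A x∈A)

    noColoops-preserved : NoColoops N A
    noColoops-preserved e e∈A with position A | role e
    ... | onlyY x∉A y∈A | _ = ⊥-elim (notYX (cyclicFlat , y∈A , x∉A))
    ... | neither x∉A y∉A | other e≢x e≢y =
      trans (r′-neither (x∉p⇒x∉p-y x∉A) (x∉p⇒x∉p-y y∉A)) (trans (noColoopsA e e∈A) (sym r′A≡ρA))
    ... | both x∈A y∈A | other e≢x e≢y =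
      trans (r′-both (x∈p⇒x∈p-y x∈A e≢x) (x∈p⇒x∈p-y y∈A e≢y)) (trans (noColoopsA e e∈A) (sym r′A≡ρA))
    ... | both x∈A y∈A | is-x refl = begin
      r′ (A - x)                                 ≡⟨ r′-onlyY (x∉p-x A x) (x∈p⇒x∈p-y y∈A x≢y) ⟩
      ρ (A - x) ⊔ ρ (swapElt x y (A - x))        ≡⟨ cong (λ T → ρ (A - x) ⊔ ρ T) (swapElt-─⁅⁆-both x∈A x≢y) ⟩
      ρ (A - x) ⊔ ρ (A - y)                      ≡⟨ cong₂ _⊔_ (noColoopsA x x∈A) (noColoopsA y y∈A) ⟩
      ρ A ⊔ ρ A                                  ≡⟨ ⊔-idem (ρ A) ⟩
      ρ A                                        ≡⟨ r′A≡ρA ⟨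
      r′ A                                       ∎
      where open ≡-Reasoning
    ... | both x∈A y∈A | is-y refl = begin
      r′ (A - y)                                 ≡⟨ r′-onlyX (x∈p⇒x∈p-y x∈A (≢-sym x≢y)) (x∉p-x A y) ⟩
      ρ (A - y) ⊓ ρ (swapElt y x (A - y))        ≡⟨ cong (λ T → ρ (A - y) ⊓ ρ T) (swapElt-─⁅⁆-both y∈A (≢-sym x≢y)) ⟩
      ρ (A - y) ⊓ ρ (A - x)                      ≡⟨ cong₂ _⊓_ (noColoopsA y y∈A) (noColoopsA x x∈A) ⟩
      ρ A ⊓ ρ A                                  ≡⟨ ⊓-idem (ρ A) ⟩
      ρ A                                        ≡⟨ r′A≡ρA ⟨
      r′ A                                       ∎
      where open ≡-Reasoning
    ... | onlyX x∈A y∉A | other e≢x e≢y =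
      trans (r′-onlyX-─⁅⁆ x∈A y∉A e≢x e≢y) (trans (rank-swapElt-─⁅⁆ cyclicFlat x∈A y∉A e∈A e≢x) (sym r′A≡ρA))
    ... | onlyX x∈A y∉A | is-x refl =
      trans (r′-neither (x∉p-x A x) (x∉p⇒x∉p-y y∉A)) (trans (noColoopsA x x∈A) (sym r′A≡ρA))
    ... | neither x∉A _ | is-x refl = ⊥-elim (x∉A e∈A)
    ... | neither _ y∉A | is-y refl = ⊥-elim (y∉A e∈A)
    ... | onlyX _ y∉A | is-y refl = ⊥-elim (y∉A e∈A)

    cyclicFlat-preserved : CyclicFlat N A
    cyclicFlat-preserved = flat-preserved , noColoops-preserved

  module _ {A} (flat′ : Flat N A) (noColoops′ : NoColoops N A) where

    cyclicFlat′-neither : x ∉ A → y ∉ A → CyclicFlat M A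
    cyclicFlat′-neither x∉A y∉A = flat , noColoops
      where
      r′A≡ρA : r′ A ≡ ρ A
      r′A≡ρA = r′-neither x∉A y∉A
      r′A<r′[A∪x] : r′ A < r′ (A ∪ ⁅ x ⁆)
      r′A<r′[A∪x] = flat′ x x∉A
      flat : Flat M A
      flat e e∉A with role e
      ... | other e≢x e≢y = <-via-≡ (sym r′A≡ρA) (sym (r′-neither (x∉p⇒x∉p∪⁅y⁆ x∉A e≢x) (x∉p⇒x∉p∪⁅y⁆ y∉A e≢y))) (flat′ e e∉A)
      ... | is-x refl = ≤-trans (≤-via-≡ (cong suc (sym r′A≡ρA)) (sym (r′-∪⁅x⁆ x∉A y∉A)) r′A<r′[A∪x]) (m⊓n≤m _ _)
      ... | is-y refl = ≤-trans (≤-via-≡ (cong suc (sym r′A≡ρA)) (sym (r′-∪⁅x⁆ x∉A y∉A)) r′A<r′[A∪x]) (m⊓n≤n _ _)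
      noColoops : NoColoops M A
      noColoops e e∈A with role e
      ... | other e≢x e≢y = trans (sym (r′-neither (x∉p⇒x∉p-y x∉A) (x∉p⇒x∉p-y y∉A))) (trans (noColoops′ e e∈A) r′A≡ρA)
      ... | is-x refl = ⊥-elim (x∉A e∈A)
      ... | is-y refl = ⊥-elim (y∉A e∈A)

    cyclicFlat′-both : x ∈ A → y ∈ A → CyclicFlat M A
    cyclicFlat′-both x∈A y∈A = flat , noColoops
      where
      r′A≡ρA : r′ A ≡ ρ A
      r′A≡ρA = r′-both x∈A y∈A
      ρA≤ρ[A-y]⊓ρ[A-x] : ρ A ≤ ρ (A - y) ⊓ ρ (A - x)
      ρA≤ρ[A-y]⊓ρ[A-x] = ≤-reflexive (begin
        ρ A                                  ≡⟨ r′A≡ρA ⟨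
        r′ A                                 ≡⟨ noColoops′ y y∈A ⟨
        r′ (A - y)                           ≡⟨ r′-onlyX (x∈p⇒x∈p-y x∈A (≢-sym x≢y)) (x∉p-x A y) ⟩
        ρ (A - y) ⊓ ρ (swapElt y x (A - y))  ≡⟨ cong (λ T → ρ (A - y) ⊓ ρ T) (swapElt-─⁅⁆-both y∈A (≢-sym x≢y)) ⟩
        ρ (A - y) ⊓ ρ (A - x)                ∎)
        where open ≡-Reasoning
      flat : Flat M A
      flat e e∉A with role e
      ... | other e≢x e≢y = <-via-≡ (sym r′A≡ρA) (sym (r′-both (x∈p⇒x∈p∪⁅y⁆ x∈A) (x∈p⇒x∈p∪⁅y⁆ y∈A))) (flat′ e e∉A)
      ... | is-x refl = ⊥-elim (e∉A x∈A)
      ... | is-y refl = ⊥-elim (e∉A y∈A)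
      noColoops : NoColoops M A
      noColoops e e∈A with role e
      ... | other e≢x e≢y =
        trans (sym (r′-both (x∈p⇒x∈p-y x∈A e≢x) (x∈p⇒x∈p-y y∈A e≢y))) (trans (noColoops′ e e∈A) r′A≡ρA)
      ... | is-x refl = ≤-antisym (rank-─⁅⁆≤ A x) (≤-trans ρA≤ρ[A-y]⊓ρ[A-x] (m⊓n≤n _ _))
      ... | is-y refl = ≤-antisym (rank-─⁅⁆≤ A y) (≤-trans ρA≤ρ[A-y]⊓ρ[A-x] (m⊓n≤m _ _))

    ¬cyclicFlat′-onlyY : x ∉ A → y ∈ A → ⊥
    ¬cyclicFlat′-onlyY x∉A y∈A = <⇒≱ r′A<ρ[A∪x] (begin
      ρ (A ∪ ⁅ x ⁆)   ≤⟨ +-cancelʳ-≤ (ρ (A - y)) _ _ (≤-trans (rank-diminishing x (p─q⊆p A ⁅ y ⁆))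
                            (+-monoʳ-≤ (ρ A) ρ[A-y∪x]≤ρ[A-y])) ⟩
      ρ A             ≤⟨ m≤m⊔n _ _ ⟩
      ρ A ⊔ ρ (swapElt x y A) ≡⟨ r′-onlyY x∉A y∈A ⟨
      r′ A            ∎)
      where
      open ≤-Reasoning
      r′A<ρ[A∪x] : r′ A < ρ (A ∪ ⁅ x ⁆)
      r′A<ρ[A∪x] = <-via-≡ refl (sym (r′-both (x∈p∪⁅x⁆ A x) (x∈p⇒x∈p∪⁅y⁆ y∈A))) (flat′ x x∉A)
      ρ[A-y∪x]≤ρ[A-y] : ρ ((A - y) ∪ ⁅ x ⁆) ≤ ρ (A - y)
      ρ[A-y∪x]≤ρ[A-y] = begin
        ρ (swapElt x y A)         ≤⟨ m≤n⊔m (ρ A) _ ⟩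
        ρ A ⊔ ρ (swapElt x y A)   ≡⟨ r′-onlyY x∉A y∈A ⟨
        r′ A                      ≡⟨ noColoops′ y y∈A ⟨
        r′ (A - y)                ≡⟨ r′-neither (x∉p⇒x∉p-y x∉A) (x∉p-x A y) ⟩
        ρ (A - y)                 ∎

    cyclicFlat′-onlyX-kept : x ∈ A → y ∉ A → ρ A ≤ ρ (swapElt y x A) → CyclicFlat M A
    cyclicFlat′-onlyX-kept x∈A y∉A ρA≤ρQ = flat , noColoops
      where
      r′A≡ρA : r′ A ≡ ρ A
      r′A≡ρA = trans (r′-onlyX x∈A y∉A) (m≤n⇒m⊓n≡m ρA≤ρQ)
      flat : Flat M A
      flat e e∉A with role e
      ... | other e≢x e≢y =
        ≤-trans (≤-via-≡ (cong suc (sym r′A≡ρA)) (sym (r′-onlyX-∪⁅⁆ x∈A y∉A e≢x e≢y)) (flat′ e e∉A)) (m⊓n≤m _ _)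
      ... | is-y refl = <-via-≡ (sym r′A≡ρA) (sym (r′-both (x∈p⇒x∈p∪⁅y⁆ x∈A) (x∈p∪⁅x⁆ A y))) (flat′ y e∉A)
      ... | is-x refl = ⊥-elim (e∉A x∈A)
      noColoops : NoColoops M A
      noColoops e e∈A with role e
      ... | other e≢x e≢y = ≤-antisym (rank-─⁅⁆≤ A e) (begin
        ρ A                                   ≡⟨ r′A≡ρA ⟨
        r′ A                                  ≡⟨ noColoops′ e e∈A ⟨
        r′ (A - e)                            ≡⟨ r′-onlyX-─⁅⁆ x∈A y∉A e≢x e≢y ⟩
        ρ (A - e) ⊓ ρ (swapElt y x A - e)     ≤⟨ m⊓n≤m _ _ ⟩
        ρ (A - e)                             ∎)
        where open ≤-Reasoning
      ... | is-x refl = trans (sym (r′-neither (x∉p-x A x) (x∉p⇒x∉p-y y∉A))) (trans (noColoops′ x e∈A) r′A≡ρA)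
      ... | is-y refl = ⊥-elim (y∉A e∈A)

    cyclicFlat′-onlyX-exchanged : x ∈ A → y ∉ A → ρ (swapElt y x A) ≤ ρ A → InZdiff M y x (swapElt y x A)
    cyclicFlat′-onlyX-exchanged x∈A y∉A ρQ≤ρA = (flat , noColoops) , y∈Q , x∉Q
      where
      Q : Subset n
      Q = swapElt y x A
      y∈Q : y ∈ Q
      y∈Q = q∈swapElt-q-p A
      x∉Q : x ∉ Q
      x∉Q = p∉swapElt-q-p A x≢y
      r′A≡ρQ : r′ A ≡ ρ Q
      r′A≡ρQ = trans (r′-onlyX x∈A y∉A) (m≥n⇒m⊓n≡n ρQ≤ρA)
      flat : Flat M Q
      flat e e∉Q with role e
      ... | other e≢x e≢y =
        ≤-trans (≤-via-≡ (cong suc (sym r′A≡ρQ)) (sym (r′-onlyX-∪⁅⁆ x∈A y∉A e≢x e≢y))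
                  (flat′ e (λ e∈A → e∉Q (x∈swapElt⁺ e∈A e≢x))))
          (m⊓n≤n _ _)
      ... | is-x refl = ≤-trans (<-via-≡ (sym r′A≡ρQ) (sym (r′-both (x∈p⇒x∈p∪⁅y⁆ x∈A) (x∈p∪⁅x⁆ A y))) (flat′ y y∉A))
                          (rank-mono (solve-⊆ (A ∷ ⁅ x ⁆ ∷ ⁅ y ⁆ ∷ []) (v₀ ∪ₑ v₂) (((v₀ ─ₑ v₁) ∪ₑ v₂) ∪ₑ v₁)))
      ... | is-y refl = ⊥-elim (e∉Q y∈Q)
      noColoops : NoColoops M Q
      noColoops e e∈Q with role e
      ... | other e≢x e≢y = ≤-antisym (rank-─⁅⁆≤ Q e) (begin
        ρ Q                                   ≡⟨ r′A≡ρQ ⟨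
        r′ A                                  ≡⟨ noColoops′ e (x∈swapElt⁻ e∈Q e≢y) ⟨
        r′ (A - e)                            ≡⟨ r′-onlyX-─⁅⁆ x∈A y∉A e≢x e≢y ⟩
        ρ (A - e) ⊓ ρ (Q - e)                 ≤⟨ m⊓n≤n _ _ ⟩
        ρ (Q - e)                             ∎)
        where open ≤-Reasoning
      ... | is-y refl = begin
        ρ (Q - y)      ≡⟨ cong ρ (p∪⁅x⁆-x≡p (x∉p⇒x∉p-y y∉A)) ⟩
        ρ (A - x)      ≡⟨ r′-neither (x∉p-x A x) (x∉p⇒x∉p-y y∉A) ⟨
        r′ (A - x)     ≡⟨ noColoops′ x x∈A ⟩
        r′ A           ≡⟨ r′A≡ρQ ⟩
        ρ Q            ∎
        where open ≡-Reasoning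
      ... | is-x refl = ⊥-elim (x∉Q e∈Q)

  cyclicFlat′⇒InZ′ : ∀ {A} → CyclicFlat N A → InZ' M x y A
  cyclicFlat′⇒InZ′ {A} (flat′ , noColoops′) with position A
  ... | neither x∉A y∉A = inj₁ (cyclicFlat′-neither flat′ noColoops′ x∉A y∉A , λ (_ , y∈A , _) → y∉A y∈A)
  ... | both x∈A y∈A = inj₁ (cyclicFlat′-both flat′ noColoops′ x∈A y∈A , λ (_ , _ , x∉A) → x∉A x∈A)
  ... | onlyY x∉A y∈A = ⊥-elim (¬cyclicFlat′-onlyY flat′ noColoops′ x∉A y∈A)
  ... | onlyX x∈A y∉A with ≤-total (ρ A) (ρ (swapElt y x A))
  ...   | inj₁ ρA≤ρQ = inj₁ (cyclicFlat′-onlyX-kept flat′ noColoops′ x∈A y∉A ρA≤ρQ , λ (_ , y∈A , _) → y∉A y∈A)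
  ...   | inj₂ ρQ≤ρA =
    inj₂ (swapElt y x A , cyclicFlat′-onlyX-exchanged flat′ noColoops′ x∈A y∉A ρQ≤ρA , sym (swapElt-involutive x∈A y∉A))

  InZ′⇒cyclicFlat′ : ∀ {A} → InZ' M x y A → CyclicFlat N A
  InZ′⇒cyclicFlat′ (inj₁ (cyclicFlat , notYX)) = cyclicFlat-preserved cyclicFlat notYX
  InZ′⇒cyclicFlat′ (inj₂ (Y , (cyclicFlat , y∈Y , x∉Y) , refl)) = Exchanged.cyclicFlat-swapped cyclicFlat y∈Y x∉Y

  isConstruction : IsConstruction M x y N
  isConstruction = (λ A → cyclicFlat′⇒InZ′ , InZ′⇒cyclicFlat′) , (λ A → r′-preserved) ,
    (λ Y (cyclicFlat , y∈Y , x∉Y) → Exchanged.r′-swapped cyclicFlat y∈Y x∉Y)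

module SameConfigurationProof {n : ℕ} (M : Matroid n) (x y : Fin n) (x≢y : x ≢ y)
  (nonModular : NonModularSeparations M x y) where

  open MatroidProperties M
  open Construction M x y x≢y
  open CyclicFlats M x y x≢y nonModular

  private
    N : Matroid n
    N = M′ nonModular

  Φ : Subset n → Subset n
  Φ F with InZdiff? y x F
  ... | yes _ = swapElt x y F
  ... | no _ = F

  Ψ : Subset n → Subset n
  Ψ G with cyclicFlat? G
  ... | yes _ = G
  ... | no _ = swapElt y x G

  Φ-moved : ∀ {F} → InZdiff M y x F → Φ F ≡ swapElt x y F
  Φ-moved {F} yx with InZdiff? y x F
  ... | yes _ = refl
  ... | no ¬yx = ⊥-elim (¬yx yx)

  Φ-fixed : ∀ {F} → ¬ InZdiff M y x F → Φ F ≡ F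
  Φ-fixed {F} ¬yx with InZdiff? y x F
  ... | yes yx = ⊥-elim (¬yx yx)
  ... | no _ = refl

  Ψ-fixed : ∀ {G} → CyclicFlat M G → Ψ G ≡ G
  Ψ-fixed {G} cyclicFlat with cyclicFlat? G
  ... | yes _ = refl
  ... | no ¬cyclicFlat = ⊥-elim (¬cyclicFlat cyclicFlat)

  Ψ-moved : ∀ {Y} → InZdiff M y x Y → Ψ (swapElt x y Y) ≡ Y
  Ψ-moved {Y} yx@(_ , y∈Y , x∉Y) with cyclicFlat? (swapElt x y Y)
  ... | yes cyclicFlat = ⊥-elim (¬cyclicFlat-swapElt yx cyclicFlat)
  ... | no _ = swapElt-involutive y∈Y x∉Y

  Φ-cf : ∀ F → CyclicFlat M F → CyclicFlat N (Φ F)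
  Φ-cf F cyclicFlat with InZdiff? y x F
  ... | yes (_ , y∈F , x∉F) = Exchanged.cyclicFlat-swapped cyclicFlat y∈F x∉F
  ... | no ¬yx = cyclicFlat-preserved cyclicFlat ¬yx

  Ψ-cf : ∀ G → CyclicFlat N G → CyclicFlat M (Ψ G)
  Ψ-cf G cyclicFlat′ with cyclicFlat′⇒InZ′ cyclicFlat′
  ... | inj₁ (cyclicFlat , _) = subst (CyclicFlat M) (sym (Ψ-fixed cyclicFlat)) cyclicFlat
  ... | inj₂ (Y , yx@(cyclicFlat , _) , refl) = subst (CyclicFlat M) (sym (Ψ-moved yx)) cyclicFlat

  ΨΦ : ∀ F → CyclicFlat M F → Ψ (Φ F) ≡ F
  ΨΦ F cyclicFlat with InZdiff? y x F
  ... | yes yx = Ψ-moved yx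
  ... | no _ = Ψ-fixed cyclicFlat

  ΦΨ : ∀ G → CyclicFlat N G → Φ (Ψ G) ≡ G
  ΦΨ G cyclicFlat′ with cyclicFlat′⇒InZ′ cyclicFlat′
  ... | inj₁ (cyclicFlat , ¬yx) = trans (cong Φ (Ψ-fixed cyclicFlat)) (Φ-fixed ¬yx)
  ... | inj₂ (Y , yx , refl) = trans (cong Φ (Ψ-moved yx)) (Φ-moved yx)

  Φ-mono : ∀ F G → CyclicFlat M F → CyclicFlat M G → F ⊆ G → Φ F ⊆ Φ G
  Φ-mono F G cyclicFlatF cyclicFlatG F⊆G with InZdiff? y x F | InZdiff? y x G
  ... | yes _ | yes _ = swapElt-mono F⊆G
  ... | no _ | no _ = F⊆G
  ... | yes (_ , y∈F , _) | no ¬yxG = p⊆q⇒p∪⁅x⁆⊆q (⊆-trans (p─q⊆p F ⁅ y ⁆) F⊆G) x∈G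
    where
    x∈G : x ∈ G
    x∈G with x ∈? G
    ... | yes x∈G = x∈G
    ... | no x∉G = ⊥-elim (¬yxG (cyclicFlatG , F⊆G y∈F , x∉G))
  ... | no ¬yxF | yes (_ , _ , x∉G) = F⊆G′
    where
    x∉F : x ∉ F
    x∉F x∈F = x∉G (F⊆G x∈F)
    F⊆G′ : F ⊆ swapElt x y G
    F⊆G′ {e} e∈F = x∈swapElt⁺ (F⊆G e∈F) (λ { refl → ¬yxF (cyclicFlatF , e∈F , x∉F) })

  Ψ-mono : ∀ F G → CyclicFlat N F → CyclicFlat N G → F ⊆ G → Ψ F ⊆ Ψ G
  Ψ-mono F G cyclicFlat′F cyclicFlat′G F⊆G with cyclicFlat′⇒InZ′ cyclicFlat′F | cyclicFlat′⇒InZ′ cyclicFlat′G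
  ... | inj₁ (cyclicFlatF , _) | inj₁ (cyclicFlatG , _) = subst₂ _⊆_ (sym (Ψ-fixed cyclicFlatF)) (sym (Ψ-fixed cyclicFlatG)) F⊆G
  ... | inj₁ (cyclicFlatF , _) | inj₂ (Y , yx@(cyclicFlatY , _ , x∉Y) , refl) =
    subst₂ _⊆_ (sym (Ψ-fixed cyclicFlatF)) (sym (Ψ-moved yx)) F⊆Y
    where
    F-x⊆Y : F - x ⊆ Y
    F-x⊆Y e∈F-x = x∈swapElt⁻ (F⊆G (p─q⊆p F ⁅ x ⁆ e∈F-x)) (λ { refl → x∉p-x F _ e∈F-x })
    x∉F : x ∉ F
    x∉F x∈F = x∉Y (p-x⊆q⇒x∈q cyclicFlatF cyclicFlatY x∈F F-x⊆Y)
    F⊆Y : F ⊆ Y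
    F⊆Y e∈F = x∈swapElt⁻ (F⊆G e∈F) (λ { refl → x∉F e∈F })
  ... | inj₂ (Y , yx@(cyclicFlatY , y∈Y , _) , refl) | inj₁ (cyclicFlatG , _) =
    subst₂ _⊆_ (sym (Ψ-moved yx)) (sym (Ψ-fixed cyclicFlatG)) Y⊆G
    where
    Y-y⊆G : Y - y ⊆ G
    Y-y⊆G e∈Y-y = F⊆G (p⊆p∪q ⁅ x ⁆ e∈Y-y)
    y∈G : y ∈ G
    y∈G = p-x⊆q⇒x∈q cyclicFlatY cyclicFlatG y∈Y Y-y⊆G
    Y⊆G : Y ⊆ G
    Y⊆G {e} e∈Y with e ≟ᶠ y
    ... | yes refl = y∈G
    ... | no e≢y = Y-y⊆G (x∈p∧x≢y⇒x∈p-y e∈Y e≢y)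
  ... | inj₂ (Y₁ , yx₁@(_ , y∈Y₁ , x∉Y₁) , refl) | inj₂ (Y₂ , yx₂@(_ , y∈Y₂ , x∉Y₂) , refl) =
    subst₂ _⊆_ (trans (swapElt-involutive y∈Y₁ x∉Y₁) (sym (Ψ-moved yx₁)))
               (trans (swapElt-involutive y∈Y₂ x∉Y₂) (sym (Ψ-moved yx₂))) (swapElt-mono F⊆G)

  Φ-size : ∀ F → CyclicFlat M F → ∣ Φ F ∣ ≡ ∣ F ∣
  Φ-size F _ with InZdiff? y x F
  ... | yes (_ , y∈F , x∉F) = ∣swapElt∣ y∈F x∉F
  ... | no _ = refl

  Φ-rank : ∀ F → CyclicFlat M F → r N (Φ F) ≡ r M F
  Φ-rank F cyclicFlat with InZdiff? y x F
  ... | yes (_ , y∈F , x∉F) = Exchanged.r′-swapped cyclicFlat y∈F x∉F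
  ... | no ¬yx = r′-preserved cyclicFlat ¬yx

  sameConfiguration : SameConfiguration M N
  sameConfiguration = record
    { Φ = Φ ; Ψ = Ψ ; Φ-cf = Φ-cf ; Ψ-cf = Ψ-cf ; ΨΦ = ΨΦ ; ΦΨ = ΦΨ
    ; Φ-mono = Φ-mono ; Ψ-mono = Ψ-mono ; Φ-size = Φ-size ; Φ-rank = Φ-rank }

-- An isomorphism invariant

lookup-≗⇒≡ : ∀ {p q : Subset n} → (∀ i → lookup p i ≡ lookup q i) → p ≡ q
lookup-≗⇒≡ {p = p} {q} eq = trans (sym (tabulate∘lookup p)) (trans (tabulate-cong eq) (tabulate∘lookup q))

module _ (σ : Permutation′ n) where

  lookup-image : ∀ X i → lookup (image σ X) i ≡ lookup X (σ ⟨$⟩ˡ i)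
  lookup-image X i = lookup∘tabulate _ i

  ∈image⁺ : ∀ {X e} → e ∈ X → σ ⟨$⟩ʳ e ∈ image σ X
  ∈image⁺ {X} {e} e∈X = lookup⇒[]= _ (image σ X)
    (trans (lookup-image X (σ ⟨$⟩ʳ e)) (trans (cong (lookup X) (inverseˡ σ)) ([]=⇒lookup e∈X)))

  ∈image⁻ : ∀ {X i} → i ∈ image σ X → σ ⟨$⟩ˡ i ∈ X
  ∈image⁻ {X} {i} i∈ = lookup⇒[]= _ X (trans (sym (lookup-image X i)) ([]=⇒lookup i∈))

  image-zipWith : ∀ f (A B : Subset n) → image σ (zipWith f A B) ≡ zipWith f (image σ A) (image σ B)
  image-zipWith f A B = lookup-≗⇒≡ λ i → begin
    lookup (image σ (zipWith f A B)) i                 ≡⟨ lookup-image (zipWith f A B) i ⟩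
    lookup (zipWith f A B) (σ ⟨$⟩ˡ i)                  ≡⟨ lookup-zipWith f (σ ⟨$⟩ˡ i) A B ⟩
    f (lookup A (σ ⟨$⟩ˡ i)) (lookup B (σ ⟨$⟩ˡ i))      ≡⟨ cong₂ f (lookup-image A i) (lookup-image B i) ⟨
    f (lookup (image σ A) i) (lookup (image σ B) i)    ≡⟨ lookup-zipWith f i (image σ A) (image σ B) ⟨
    lookup (zipWith f (image σ A) (image σ B)) i       ∎
    where open ≡-Reasoning

  image-⁅⁆ : ∀ e → image σ ⁅ e ⁆ ≡ ⁅ σ ⟨$⟩ʳ e ⁆
  image-⁅⁆ e = ⊆-antisym forth back
    where
    forth : image σ ⁅ e ⁆ ⊆ ⁅ σ ⟨$⟩ʳ e ⁆
    forth i∈ = subst (_∈ ⁅ σ ⟨$⟩ʳ e ⁆) (trans (cong (σ ⟨$⟩ʳ_) (sym (x∈⁅y⁆⇒x≡y e (∈image⁻ i∈)))) (inverseʳ σ)) (x∈⁅x⁆ _)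
    back : ⁅ σ ⟨$⟩ʳ e ⁆ ⊆ image σ ⁅ e ⁆
    back i∈ = subst (_∈ image σ ⁅ e ⁆) (sym (x∈⁅y⁆⇒x≡y _ i∈)) (∈image⁺ (x∈⁅x⁆ e))

  image-∪⁅⁆ : ∀ X e → image σ (X ∪ ⁅ e ⁆) ≡ image σ X ∪ ⁅ σ ⟨$⟩ʳ e ⁆
  image-∪⁅⁆ X e = trans (image-zipWith _ X ⁅ e ⁆) (cong (λ S → image σ X ∪ S) (image-⁅⁆ e))

  image-─⁅⁆ : ∀ X e → image σ (X - e) ≡ image σ X - (σ ⟨$⟩ʳ e)
  image-─⁅⁆ X e = trans (image-zipWith _ X ⁅ e ⁆) (cong (λ S → image σ X ─ S) (image-⁅⁆ e))

  image-flip : ∀ X → image σ (image (flip σ) X) ≡ X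
  image-flip X = lookup-≗⇒≡ λ i →
    trans (lookup-image (image (flip σ) X) i) (trans (lookup∘tabulate _ (σ ⟨$⟩ˡ i)) (cong (lookup X) (inverseʳ σ)))

isomorphic-sym : ∀ {M N : Matroid n} → Isomorphic M N → Isomorphic N M
isomorphic-sym {N = N} (σ , iso) = flip σ , λ X → trans (sym (iso (image (flip σ) X))) (cong (r N) (image-flip σ X))

module _ {M N : Matroid n} (σ : Permutation′ n) (iso : ∀ X → r N (image σ X) ≡ r M X) where

  cyclicFlat-image : ∀ {G} → CyclicFlat M G → CyclicFlat N (image σ G)
  cyclicFlat-image {G} (flatG , noColoopsG) = flat , noColoops
    where
    flat : Flat N (image σ G)
    flat e′ e′∉ = begin-strict
      r N (image σ G)                        ≡⟨ iso G ⟩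
      r M G                                  <⟨ flatG (σ ⟨$⟩ˡ e′) (λ e∈G → e′∉ (subst (_∈ image σ G) (inverseʳ σ) (∈image⁺ σ e∈G))) ⟩
      r M (G ∪ ⁅ σ ⟨$⟩ˡ e′ ⁆)                ≡⟨ iso (G ∪ ⁅ σ ⟨$⟩ˡ e′ ⁆) ⟨
      r N (image σ (G ∪ ⁅ σ ⟨$⟩ˡ e′ ⁆))      ≡⟨ cong (r N) (trans (image-∪⁅⁆ σ G _) (cong (λ i → image σ G ∪ ⁅ i ⁆) (inverseʳ σ))) ⟩
      r N (image σ G ∪ ⁅ e′ ⁆)               ∎
      where open ≤-Reasoning
    noColoops : NoColoops N (image σ G)
    noColoops e′ e′∈ = begin
      r N (image σ G - e′)                   ≡⟨ cong (λ i → r N (image σ G - i)) (inverseʳ σ) ⟨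
      r N (image σ G - (σ ⟨$⟩ʳ (σ ⟨$⟩ˡ e′))) ≡⟨ cong (r N) (image-─⁅⁆ σ G _) ⟨
      r N (image σ (G - (σ ⟨$⟩ˡ e′)))        ≡⟨ iso _ ⟩
      r M (G - (σ ⟨$⟩ˡ e′))                  ≡⟨ noColoopsG _ (∈image⁻ σ e′∈) ⟩
      r M G                                  ≡⟨ iso G ⟨
      r N (image σ G)                        ∎
      where open ≡-Reasoning

  InZdiff-image : ∀ {f e} → ∃ (InZdiff M f e) → ∃ (InZdiff N (σ ⟨$⟩ʳ f) (σ ⟨$⟩ʳ e))
  InZdiff-image (G , cyclicFlat , f∈G , e∉G) =
    image σ G , cyclicFlat-image cyclicFlat , ∈image⁺ σ f∈G ,
    λ σe∈ → e∉G (subst (_∈ G) (inverseˡ σ) (∈image⁻ σ σe∈))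

𝟙 : ∀ {P : Set} → Dec P → ℕ
𝟙 (yes _) = 1
𝟙 (no _) = 0

𝟙-yes : ∀ {P : Set} (p? : Dec P) → P → 𝟙 p? ≡ 1
𝟙-yes (yes _) _ = refl
𝟙-yes (no ¬p) p = ⊥-elim (¬p p)

𝟙-no : ∀ {P : Set} (p? : Dec P) → ¬ P → 𝟙 p? ≡ 0
𝟙-no (yes p) ¬p = ⊥-elim (¬p p)
𝟙-no (no _) _ = refl

𝟙-cong : ∀ {P Q : Set} (p? : Dec P) (q? : Dec Q) → (P → Q) → (Q → P) → 𝟙 p? ≡ 𝟙 q?
𝟙-cong (yes _) (yes _) _ _ = refl
𝟙-cong (no _) (no _) _ _ = refl
𝟙-cong (yes p) (no ¬q) to _ = ⊥-elim (¬q (to p))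
𝟙-cong (no ¬p) (yes q) _ from = ⊥-elim (¬p (from q))

𝟙-mono : ∀ {P Q : Set} (p? : Dec P) (q? : Dec Q) → (P → Q) → 𝟙 p? ≤ 𝟙 q?
𝟙-mono (no _) _ _ = z≤n
𝟙-mono (yes _) (yes _) _ = ≤-refl
𝟙-mono (yes p) (no ¬q) to = ⊥-elim (¬q (to p))

𝟙-+-mono : ∀ {A B C D : Set} (a? : Dec A) (b? : Dec B) (c? : Dec C) (d? : Dec D) →
  (C → D → A) → (C → B) → (D → B) → 𝟙 c? + 𝟙 d? ≤ 𝟙 a? + 𝟙 b?
𝟙-+-mono a? b? (no _) (no _) _ _ _ = z≤n
𝟙-+-mono a? b? (yes c) (no _) _ c→b _ = ≤-trans (𝟙-mono (yes c) b? c→b) (m≤n+m _ (𝟙 a?))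
𝟙-+-mono a? b? (no _) (yes d) _ _ d→b = ≤-trans (𝟙-mono (yes d) b? d→b) (m≤n+m _ (𝟙 a?))
𝟙-+-mono a? b? (yes c) (yes d) cd→a c→b _ = +-mono-≤ (𝟙-mono (yes c) a? (λ _ → cd→a c d)) (𝟙-mono (yes c) b? c→b)

module _ (N : Matroid n) where

  Forces : Fin n → Fin n → Set
  Forces f e = ¬ ∃ (InZdiff N f e)

  forces? : ∀ f e → Dec (Forces f e)
  forces? f e = ¬? (anySubset? (MatroidProperties.InZdiff? N f e))

  forcingCount : ℕ
  forcingCount = sum λ f → sum λ e → 𝟙 (forces? f e)

forces-refl : ∀ (N : Matroid n) e → Forces N e e
forces-refl N e (_ , _ , e∈G , e∉G) = e∉G e∈G

forcingCount-invariant : ∀ {M N : Matroid n} → Isomorphic M N → forcingCount M ≡ forcingCount N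
forcingCount-invariant {M = M} {N} iso@(σ , rank-iso) = begin
  sum (λ f → sum λ e → 𝟙 (forces? M f e))
    ≡⟨ sum-cong-≗ (λ f → sum-cong-≗ λ e → 𝟙-cong (forces? M f e) (forces? N _ _) to (from f e)) ⟩
  sum (λ f → sum λ e → 𝟙 (forces? N (σ ⟨$⟩ʳ f) (σ ⟨$⟩ʳ e)))
    ≡⟨ sum-cong-≗ (λ f → sum-permute (λ e → 𝟙 (forces? N (σ ⟨$⟩ʳ f) e)) σ) ⟨
  sum (λ f → sum λ e → 𝟙 (forces? N (σ ⟨$⟩ʳ f) e))
    ≡⟨ sum-permute (λ f → sum λ e → 𝟙 (forces? N f e)) σ ⟨
  sum (λ f → sum λ e → 𝟙 (forces? N f e)) ∎
  where
  open ≡-Reasoning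
  to : ∀ {f e} → Forces M f e → Forces N (σ ⟨$⟩ʳ f) (σ ⟨$⟩ʳ e)
  to {f} {e} forcesM separatedN = forcesM (subst₂ (λ f e → ∃ (InZdiff M f e)) (inverseˡ σ) (inverseˡ σ)
    (InZdiff-image {M = N} {N = M} (flip σ) (proj₂ (isomorphic-sym {M = M} {N = N} iso)) separatedN))
  from : ∀ f e → Forces N (σ ⟨$⟩ʳ f) (σ ⟨$⟩ʳ e) → Forces M f e
  from f e forcesN separatedM = forcesN (InZdiff-image {M = M} {N = N} σ rank-iso separatedM)

sum-mono-≤ : ∀ {n} (f g : Fin n → ℕ) → (∀ i → f i ≤ g i) → sum f ≤ sum g
sum-mono-≤ {zero} f g f≤g = z≤n
sum-mono-≤ {suc n} f g f≤g = +-mono-≤ (f≤g zero) (sum-mono-≤ (λ i → f (suc i)) (λ i → g (suc i)) (λ i → f≤g (suc i)))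

sum-mono-< : ∀ {n} (f g : Fin n → ℕ) → (∀ i → f i ≤ g i) → ∀ j → f j < g j → sum f < sum g
sum-mono-< {suc n} f g f≤g zero fj<gj = +-mono-<-≤ fj<gj (sum-mono-≤ (λ i → f (suc i)) (λ i → g (suc i)) (λ i → f≤g (suc i)))
sum-mono-< {suc n} f g f≤g (suc j) fj<gj =
  +-mono-≤-< (f≤g zero) (sum-mono-< (λ i → f (suc i)) (λ i → g (suc i)) (λ i → f≤g (suc i)) j fj<gj)

sum-+-permuted : ∀ (σ : Permutation′ n) (c : Fin n → Fin n → ℕ) →
  sum (λ f → sum λ e → c f e + c (σ ⟨$⟩ʳ f) (σ ⟨$⟩ʳ e)) ≡ sum (λ f → sum (c f)) + sum (λ f → sum (c f))
sum-+-permuted σ c = begin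
  sum (λ f → sum λ e → c f e + c (σ ⟨$⟩ʳ f) (σ ⟨$⟩ʳ e))
    ≡⟨ sum-cong-≗ (λ f → ∑-distrib-+ (c f) (λ e → c (σ ⟨$⟩ʳ f) (σ ⟨$⟩ʳ e))) ⟩
  sum (λ f → sum (c f) + sum λ e → c (σ ⟨$⟩ʳ f) (σ ⟨$⟩ʳ e))
    ≡⟨ ∑-distrib-+ (λ f → sum (c f)) (λ f → sum λ e → c (σ ⟨$⟩ʳ f) (σ ⟨$⟩ʳ e)) ⟩
  sum (λ f → sum (c f)) + sum (λ f → sum λ e → c (σ ⟨$⟩ʳ f) (σ ⟨$⟩ʳ e))
    ≡⟨ cong (sum (λ f → sum (c f)) +_) (trans (sum-cong-≗ λ f → sym (sum-permute (c (σ ⟨$⟩ʳ f)) σ))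
                                             (sym (sum-permute (λ f → sum (c f)) σ))) ⟩
  sum (λ f → sum (c f)) + sum (λ f → sum (c f)) ∎
  where open ≡-Reasoning

module Separations {n : ℕ} (M : Matroid n) (x y : Fin n) (x≢y : x ≢ y)
  (nonModular : NonModularSeparations M x y) where

  open Construction M x y x≢y using (M′)
  open CyclicFlats M x y x≢y nonModular using (cyclicFlat′⇒InZ′)

  private
    N : Matroid n
    N = M′ nonModular

  separation′ : ∀ {f e G} → InZdiff N f e G →
    (InZdiff M f e G × ¬ InZdiff M y x G) ⊎ ∃ λ Y → InZdiff M y x Y × f ∈ swapElt x y Y × e ∉ swapElt x y Y
  separation′ (cyclicFlat′ , f∈G , e∉G) with cyclicFlat′⇒InZ′ cyclicFlat′
  ... | inj₁ (cyclicFlat , ¬yx) = inj₁ ((cyclicFlat , f∈G , e∉G) , ¬yx)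
  ... | inj₂ (Y , yx , refl) = inj₂ (Y , yx , f∈G , e∉G)

  forces′-others : ∀ {f e} → f ≢ x → e ≢ y → Forces M f e → Forces N f e
  forces′-others f≢x e≢y forces (G , separates) with separation′ separates
  ... | inj₁ (separatesM , _) = forces (G , separatesM)
  ... | inj₂ (Y , (cyclicFlat , _) , f∈ , e∉) = forces (Y , cyclicFlat , x∈swapElt⁻ f∈ f≢x , λ e∈Y → e∉ (x∈swapElt⁺ e∈Y e≢y))

  forces′-from-x : ∀ {e} → e ≢ y → Forces M x e → Forces M y e → Forces N x e
  forces′-from-x e≢y forcesX forcesY (G , separates) with separation′ separates
  ... | inj₁ (separatesM , _) = forcesX (G , separatesM)
  ... | inj₂ (Y , (cyclicFlat , y∈Y , _) , _ , e∉) = forcesY (Y , cyclicFlat , y∈Y , λ e∈Y → e∉ (x∈swapElt⁺ e∈Y e≢y))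

  forces′-from-y : ∀ {e} → (Forces M x e ⊎ Forces M y e) → Forces N y e
  forces′-from-y {e} forces (G , separates) with separation′ separates
  ... | inj₂ (Y , _ , y∈ , _) = p∉swapElt-q-p Y (≢-sym x≢y) y∈
  ... | inj₁ ((cyclicFlat , y∈G , e∉G) , ¬yx) with forces | x ∈? G
  ...   | inj₂ forcesY | _ = forcesY (G , cyclicFlat , y∈G , e∉G)
  ...   | inj₁ forcesX | yes x∈G = forcesX (G , cyclicFlat , x∈G , e∉G)
  ...   | inj₁ _ | no x∉G = ¬yx (cyclicFlat , y∈G , x∉G)

  forces′-to-x : ∀ {f} → (Forces M f x ⊎ Forces M f y) → Forces N f x
  forces′-to-x {f} forces (G , separates) with separation′ separates
  ... | inj₂ (Y , _ , _ , x∉) = x∉ (q∈swapElt-q-p Y)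
  ... | inj₁ ((cyclicFlat , f∈G , x∉G) , ¬yx) with forces | y ∈? G
  ...   | inj₁ forcesX | _ = forcesX (G , cyclicFlat , f∈G , x∉G)
  ...   | inj₂ _ | yes y∈G = ¬yx (cyclicFlat , y∈G , x∉G)
  ...   | inj₂ forcesY | no y∉G = forcesY (G , cyclicFlat , f∈G , y∉G)

  forces′-to-y : ∀ {f} → f ≢ x → Forces M f x → Forces M f y → Forces N f y
  forces′-to-y f≢x forcesX forcesY (G , separates) with separation′ separates
  ... | inj₁ (separatesM , _) = forcesY (G , separatesM)
  ... | inj₂ (Y , (cyclicFlat , _ , x∉Y) , f∈ , _) = forcesX (Y , cyclicFlat , x∈swapElt⁻ f∈ f≢x , x∉Y)

  forces′-y-x : Forces N y x
  forces′-y-x (G , separates) with separation′ separates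
  ... | inj₁ ((cyclicFlat , y∈G , x∉G) , ¬yx) = ¬yx (cyclicFlat , y∈G , x∉G)
  ... | inj₂ (Y , _ , y∈ , _) = p∉swapElt-q-p Y (≢-sym x≢y) y∈

transpose-matchˡ : ∀ (i j : Fin n) → PC.transpose i j i ≡ j
transpose-matchˡ i j rewrite dec-true (i ≟ᶠ i) refl = refl

transpose-matchʳ : ∀ (i j : Fin n) → PC.transpose i j j ≡ i
transpose-matchʳ i j with j ≟ᶠ i
... | yes j≡i = j≡i
... | no _ rewrite dec-true (j ≟ᶠ j) refl = refl

transpose-other : ∀ {i j k : Fin n} → k ≢ i → k ≢ j → PC.transpose i j k ≡ k
transpose-other {i = i} {j} {k} k≢i k≢j rewrite dec-false (k ≟ᶠ i) k≢i | dec-false (k ≟ᶠ j) k≢j = refl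

module NonIsomorphism {n : ℕ} (M : Matroid n) (x y : Fin n) (x≢y : x ≢ y)
  (nonModular : NonModularSeparations M x y)
  (xy : ∃ (InZdiff M x y)) (yx : ∃ (InZdiff M y x)) where

  open Construction M x y x≢y using (M′; Role; role; is-x; is-y; other)
  open Separations M x y x≢y nonModular

  private
    N : Matroid n
    N = M′ nonModular
    τ : Permutation′ n
    τ = transpose x y
    a b : Fin n → Fin n → ℕ
    a f e = 𝟙 (forces? M f e)
    b f e = 𝟙 (forces? N f e)

  private
    into : ∀ {f} → f ≢ x → a f x + a f y ≤ b f y + b f x
    into {f} f≢x = 𝟙-+-mono (forces? N f y) (forces? N f x) (forces? M f x) (forces? M f y)
      (forces′-to-y f≢x) (λ forcesX → forces′-to-x (inj₁ forcesX)) (λ forcesY → forces′-to-x (inj₂ forcesY))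
    out-of : ∀ {e} → e ≢ y → a x e + a y e ≤ b x e + b y e
    out-of {e} e≢y = 𝟙-+-mono (forces? N x e) (forces? N y e) (forces? M x e) (forces? M y e)
      (forces′-from-x e≢y) (λ forcesX → forces′-from-y (inj₁ forcesX)) (λ forcesY → forces′-from-y (inj₂ forcesY))
    reflexive : ∀ e → a e e ≤ b e e
    reflexive e = 𝟙-mono (forces? M e e) (forces? N e e) (λ _ → forces-refl N e)
    separated : ∀ {f e} → ∃ (InZdiff M f e) → a f e ≤ b f e
    separated {f} {e} separation = 𝟙-mono (forces? M f e) (forces? N f e) (λ forces → ⊥-elim (forces separation))

  forcing-pair : ∀ f e → a f e + a (τ ⟨$⟩ʳ f) (τ ⟨$⟩ʳ e) ≤ b f e + b (τ ⟨$⟩ʳ f) (τ ⟨$⟩ʳ e)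
  forcing-pair f e with role f | role e
  ... | other f≢x f≢y | other e≢x e≢y rewrite transpose-other f≢x f≢y | transpose-other e≢x e≢y =
    +-mono-≤ (𝟙-mono (forces? M f e) (forces? N f e) (forces′-others f≢x e≢y))
             (𝟙-mono (forces? M f e) (forces? N f e) (forces′-others f≢x e≢y))
  ... | other f≢x f≢y | is-x refl rewrite transpose-other f≢x f≢y | transpose-matchˡ x y =
    ≤-trans (into f≢x) (≤-reflexive (+-comm (b f y) (b f x)))
  ... | other f≢x f≢y | is-y refl rewrite transpose-other f≢x f≢y | transpose-matchʳ x y =
    ≤-trans (≤-reflexive (+-comm (a f y) (a f x))) (into f≢x)
  ... | is-x refl | other e≢x e≢y rewrite transpose-matchˡ x y | transpose-other e≢x e≢y = out-of e≢y
  ... | is-y refl | other e≢x e≢y rewrite transpose-matchʳ x y | transpose-other e≢x e≢y =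
    ≤-trans (≤-reflexive (+-comm (a y e) (a x e))) (≤-trans (out-of e≢y) (≤-reflexive (+-comm (b x e) (b y e))))
  ... | is-x refl | is-x refl rewrite transpose-matchˡ x y = +-mono-≤ (reflexive x) (reflexive y)
  ... | is-y refl | is-y refl rewrite transpose-matchʳ x y = +-mono-≤ (reflexive y) (reflexive x)
  ... | is-x refl | is-y refl rewrite transpose-matchˡ x y | transpose-matchʳ x y = +-mono-≤ (separated xy) (separated yx)
  ... | is-y refl | is-x refl rewrite transpose-matchˡ x y | transpose-matchʳ x y = +-mono-≤ (separated yx) (separated xy)

  forcingCount-< : forcingCount M + forcingCount M < forcingCount N + forcingCount N
  forcingCount-< = subst₂ _<_ (sum-+-permuted τ a) (sum-+-permuted τ b)
    (sum-mono-< _ _ (λ f → sum-mono-≤ _ _ (forcing-pair f)) x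
      (sum-mono-< _ _ (forcing-pair x) y strict))
    where
    strict : a x y + a (τ ⟨$⟩ʳ x) (τ ⟨$⟩ʳ y) < b x y + b (τ ⟨$⟩ʳ x) (τ ⟨$⟩ʳ y)
    strict rewrite transpose-matchˡ x y | transpose-matchʳ x y
                 | 𝟙-no (forces? M x y) (λ forces → forces xy) | 𝟙-no (forces? M y x) (λ forces → forces yx)
                 | 𝟙-yes (forces? N y x) forces′-y-x = m≤n+m 1 (b x y)

  nonIsomorphic : ¬ Isomorphic M N
  nonIsomorphic iso = <-irrefl (cong₂ _+_ same same) forcingCount-<
    where
    same : forcingCount M ≡ forcingCount N
    same = forcingCount-invariant {M = M} {N = N} iso

-- Interchanging x and y

module Symmetry {n : ℕ} (M : Matroid n) (x y : Fin n) (x≢y : x ≢ y) where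

  module C = Construction M x y x≢y
  module C″ = Construction M y x (≢-sym x≢y)

  private
    τ : Permutation′ n
    τ = transpose x y

  image-transpose-fixed : ∀ {S} → (x ∈ S → y ∈ S) → (y ∈ S → x ∈ S) → image τ S ≡ S
  image-transpose-fixed {S} x→y y→x = lookup-≗⇒≡ λ i → trans (lookup-image τ S i) (fixed i)
    where
    fixed : ∀ i → lookup S (τ ⟨$⟩ˡ i) ≡ lookup S i
    fixed i with C.role i
    ... | C.is-x refl = trans (cong (lookup S) (transpose-matchʳ y x)) (lookup-⇔ y→x x→y)
    ... | C.is-y refl = trans (cong (lookup S) (transpose-matchˡ y x)) (lookup-⇔ x→y y→x)
    ... | C.other i≢x i≢y = cong (lookup S) (transpose-other i≢y i≢x)

  image-transpose-onlyX : ∀ {S} → x ∈ S → y ∉ S → image τ S ≡ swapElt y x S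
  image-transpose-onlyX {S} x∈S y∉S = begin
    image τ S                          ≡⟨ cong (image τ) (p-x∪⁅x⁆≡p x∈S) ⟨
    image τ ((S - x) ∪ ⁅ x ⁆)          ≡⟨ image-∪⁅⁆ τ (S - x) x ⟩
    image τ (S - x) ∪ ⁅ τ ⟨$⟩ʳ x ⁆     ≡⟨ cong₂ (λ T i → T ∪ ⁅ i ⁆) S-x-fixed (transpose-matchˡ x y) ⟩
    (S - x) ∪ ⁅ y ⁆                    ∎
    where
    open ≡-Reasoning
    S-x-fixed : image τ (S - x) ≡ S - x
    S-x-fixed = image-transpose-fixed (λ x∈ → ⊥-elim (x∉p-x S x x∈)) (λ y∈ → ⊥-elim (y∉S (p─q⊆p S ⁅ x ⁆ y∈)))

  image-transpose-onlyY : ∀ {S} → x ∉ S → y ∈ S → image τ S ≡ swapElt x y S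
  image-transpose-onlyY {S} x∉S y∈S = begin
    image τ S                          ≡⟨ cong (image τ) (p-x∪⁅x⁆≡p y∈S) ⟨
    image τ ((S - y) ∪ ⁅ y ⁆)          ≡⟨ image-∪⁅⁆ τ (S - y) y ⟩
    image τ (S - y) ∪ ⁅ τ ⟨$⟩ʳ y ⁆     ≡⟨ cong₂ (λ T i → T ∪ ⁅ i ⁆) S-y-fixed (transpose-matchʳ x y) ⟩
    (S - y) ∪ ⁅ x ⁆                    ∎
    where
    open ≡-Reasoning
    S-y-fixed : image τ (S - y) ≡ S - y
    S-y-fixed = image-transpose-fixed (λ x∈ → ⊥-elim (x∉S (p─q⊆p S ⁅ y ⁆ x∈))) (λ y∈ → ⊥-elim (x∉p-x S y y∈))

  r″∘τ≡r′ : ∀ S → C″.r′ (image τ S) ≡ C.r′ S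
  r″∘τ≡r′ S with C.position S
  ... | C.neither x∉S y∉S = begin
    C″.r′ (image τ S)                    ≡⟨ cong C″.r′ (image-transpose-fixed (λ x∈S → ⊥-elim (x∉S x∈S)) (λ y∈S → ⊥-elim (y∉S y∈S))) ⟩
    C″.r′ S                              ≡⟨ C″.r′-neither y∉S x∉S ⟩
    r M S                                ≡⟨ C.r′-neither x∉S y∉S ⟨
    C.r′ S                               ∎
    where open ≡-Reasoning
  ... | C.both x∈S y∈S = begin
    C″.r′ (image τ S)                    ≡⟨ cong C″.r′ (image-transpose-fixed (λ _ → y∈S) (λ _ → x∈S)) ⟩
    C″.r′ S                              ≡⟨ C″.r′-both y∈S x∈S ⟩
    r M S                                ≡⟨ C.r′-both x∈S y∈S ⟨
    C.r′ S                               ∎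
    where open ≡-Reasoning
  ... | C.onlyX x∈S y∉S = begin
    C″.r′ (image τ S)                    ≡⟨ cong C″.r′ (image-transpose-onlyX x∈S y∉S) ⟩
    C″.r′ S′                             ≡⟨ C″.r′-onlyX (q∈swapElt-q-p S) (p∉swapElt-q-p S x≢y) ⟩
    r M S′ ⊓ r M (swapElt x y S′)        ≡⟨ cong (λ U → r M S′ ⊓ r M U) (swapElt-involutive x∈S y∉S) ⟩
    r M S′ ⊓ r M S                       ≡⟨ ⊓-comm (r M S′) (r M S) ⟩
    r M S ⊓ r M S′                       ≡⟨ C.r′-onlyX x∈S y∉S ⟨
    C.r′ S                               ∎
    where
    open ≡-Reasoning
    S′ : Subset n
    S′ = swapElt y x S
  ... | C.onlyY x∉S y∈S = begin
    C″.r′ (image τ S)                    ≡⟨ cong C″.r′ (image-transpose-onlyY x∉S y∈S) ⟩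
    C″.r′ S′                             ≡⟨ C″.r′-onlyY (p∉swapElt-q-p S (≢-sym x≢y)) (q∈swapElt-q-p S) ⟩
    r M S′ ⊔ r M (swapElt y x S′)        ≡⟨ cong (λ U → r M S′ ⊔ r M U) (swapElt-involutive y∈S x∉S) ⟩
    r M S′ ⊔ r M S                       ≡⟨ ⊔-comm (r M S′) (r M S) ⟩
    r M S ⊔ r M S′                       ≡⟨ C.r′-onlyY x∉S y∈S ⟨
    C.r′ S                               ∎
    where
    open ≡-Reasoning
    S′ : Subset n
    S′ = swapElt x y S

theorem3p1 : {n : ℕ} (M : Matroid n) (x y : Fin n) →
    ∃ (InZdiff M x y) →
    ∃ (InZdiff M y x) →
    (∀ X Y → InZdiff M x y X → InZdiff M y x Y → ¬ Modular M X Y) →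
    Σ (Matroid n) λ M' →
      IsConstruction M x y M'
      × SameConfiguration M M'
      × ¬ Isomorphic M M'
      × Σ (Matroid n) (λ M'' → IsConstruction M y x M'' × Isomorphic M' M'')
theorem3p1 {n} M x y xy@(_ , _ , x∈X , y∉X) yx nonModular =
  M′ nonModular , isConstruction , sameConfiguration , nonIsomorphic ,
  M″ , isConstruction″ , (transpose x y , r″∘τ≡r′)
  where
  x≢y : x ≢ y
  x≢y refl = y∉X x∈X
  open Construction M x y x≢y using (M′)
  open CyclicFlats M x y x≢y nonModular using (isConstruction)
  open SameConfigurationProof M x y x≢y nonModular using (sameConfiguration)
  open NonIsomorphism M x y x≢y nonModular xy yx using (nonIsomorphic)
  open Symmetry M x y x≢y using (r″∘τ≡r′)
  nonModular′ : NonModularSeparations M y x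
  nonModular′ = nonModularSeparations-sym {M = M} nonModular
  M″ : Matroid n
  M″ = Construction.M′ M y x (≢-sym x≢y) nonModular′
  isConstruction″ : IsConstruction M y x M″
  isConstruction″ = CyclicFlats.isConstruction M y x (≢-sym x≢y) nonModular′
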